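{- For any $q\geq 2$ and $n\geq 1$, we have the tensor degeneration \[ \mathrm{cw}_q^{\otimes n} \oplus \langle 1, (q+2)^n - 2(q+1)^n + q^n, 1\rangle \trianglelefteq \langle (q+2)^n\rangle \oplus \langle 1,q^n,1\rangle. \]
   Context: $\mathrm{cw}_q = \sum_{i=1}^q x_0 y_i z_i + x_i y_0 z_i + x_i y_i z_0$ is the small Coppersmith--Winograd tensor. $\langle r\rangle$ is the diagonal tensor of size $r$, $\langle 1,s,1\rangle$ the one-slice matrix multiplication tensor (a rank-$s$ matrix slice), $\trianglelefteq$ degeneration. -}

module Defs where

open import Level using (Level; _⊔_)
open import Data.Nat as ℕ using (ℕ; zero; suc; _∸_; _<_)
open import Data.Fin as Fin using (Fin; zero; suc; splitAt; remQuot)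
open import Data.Sum using (inj₁; inj₂)
open import Data.Product using (Σ; ∃; _×_; _,_; proj₁; proj₂)
open import Relation.Nullary using (¬_; yes; no)
open import Algebra.Bundles using (CommutativeRing)

module _ {c ℓ : Level} (R : CommutativeRing c ℓ) where
  open CommutativeRing R using (Carrier; _≈_; _+_; _*_; 0#; 1#)

  natCast : ℕ → Carrier
  natCast zero    = 0#
  natCast (suc n) = 1# + natCast n

  record IsChar0Field : Set (c ⊔ ℓ) where
    field
      1≉0     : ¬ (1# ≈ 0#)
      inverse : ∀ x → ¬ (x ≈ 0#) → Σ Carrier (λ y → x * y ≈ 1#)
      char0   : ∀ n → ¬ (natCast (suc n) ≈ 0#)

module Tensors {c ℓ : Level} (R : CommutativeRing c ℓ) where
  open CommutativeRing R using (Carrier; _≈_; _+_; _*_; 0#; 1#)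

  Tensor : ℕ → ℕ → ℕ → Set c
  Tensor a b d = Fin a → Fin b → Fin d → Carrier

  ΣFin : (n : ℕ) → (Fin n → Carrier) → Carrier
  ΣFin zero    f = 0#
  ΣFin (suc n) f = f zero + ΣFin n (λ i → f (suc i))

  Σ≤ : (m : ℕ) → (ℕ → Carrier) → Carrier
  Σ≤ zero    f = f zero
  Σ≤ (suc m) f = f zero + Σ≤ m (λ p → f (suc p))

  δ : {n : ℕ} → Fin n → Fin n → Carrier
  δ i j with i Fin.≟ j
  ... | yes _ = 1#
  ... | no  _ = 0#

  _⊕_ : ∀ {a b d a' b' d'} → Tensor a b d → Tensor a' b' d' →
        Tensor (a ℕ.+ a') (b ℕ.+ b') (d ℕ.+ d')
  _⊕_ {a} {b} {d} T S i j k with splitAt a i | splitAt b j | splitAt d k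
  ... | inj₁ i₁ | inj₁ j₁ | inj₁ k₁ = T i₁ j₁ k₁
  ... | inj₂ i₂ | inj₂ j₂ | inj₂ k₂ = S i₂ j₂ k₂
  ... | _       | _       | _       = 0#

  _⊗_ : ∀ {a b d a' b' d'} → Tensor a b d → Tensor a' b' d' →
        Tensor (a ℕ.* a') (b ℕ.* b') (d ℕ.* d')
  _⊗_ {a' = a'} {b' = b'} {d' = d'} T S i j k =
    let (i₁ , i₂) = remQuot a' i
        (j₁ , j₂) = remQuot b' j
        (k₁ , k₂) = remQuot d' k
    in T i₁ j₁ k₁ * S i₂ j₂ k₂

  _⊗^_ : ∀ {a b d} → Tensor a b d → (n : ℕ) → Tensor (a ℕ.^ n) (b ℕ.^ n) (d ℕ.^ n)
  T ⊗^ zero    = λ _ _ _ → 1#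
  T ⊗^ (suc n) = T ⊗ (T ⊗^ n)

  cw : (q : ℕ) → Tensor (suc q) (suc q) (suc q)
  cw q zero    (suc j) (suc k) = δ j k
  cw q (suc i) zero    (suc k) = δ i k
  cw q (suc i) (suc j) zero    = δ i j
  cw q _       _       _       = 0#

  unit : (r : ℕ) → Tensor r r r
  unit r i j k with i Fin.≟ j | j Fin.≟ k
  ... | yes _ | yes _ = 1#
  ... | _     | _     = 0#

  -- Matrix multiplication tensor ⟨1,s,1⟩ = Σ_{j=1}^s x_{1j} y_{j1} z_{11}
  -- (formats: 1·s, s·1, 1·1)
  mm1s1 : (s : ℕ) → Tensor s s 1
  mm1s1 s i j _ = δ i j

  -- Matrices whose entries are polynomials in ε, given by the sequence of
  -- coefficient matrices (M p = coefficient of ε^p), with a degree bound.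
  PolyMat : ℕ → ℕ → Set c
  PolyMat m n = ℕ → Fin m → Fin n → Carrier

  IsPolynomial : ∀ {m n} → PolyMat m n → Set ℓ
  IsPolynomial {m} {n} M =
    Σ ℕ (λ D → ∀ p → D < p → ∀ (i : Fin m) (j : Fin n) → M p i j ≈ 0#)

  -- Coefficient of ε^m in ((A ⊗ B ⊗ C) · S)_{ijk}
  --   = Σ_{p+p'+p''=m} Σ_{i',j',k'} A_p[i,i'] B_p'[j,j'] C_p''[k,k'] S[i',j',k']
  coeff : ∀ {a b d a' b' d'} →
          PolyMat a a' → PolyMat b b' → PolyMat d d' → Tensor a' b' d' →
          ℕ → Tensor a b d
  coeff {a' = a'} {b' = b'} {d' = d'} A B C S m i j k =
    Σ≤ m (λ p → Σ≤ (m ∸ p) (λ p' →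
      ΣFin a' (λ i' → ΣFin b' (λ j' → ΣFin d' (λ k' →
        A p i i' * B p' j j' * C ((m ∸ p) ∸ p') k k' * S i' j' k')))))

  -- Degeneration T ⊴ S (Strassen / Bürgisser–Clausen–Shokrollahi):
  -- there are matrices A, B, C with entries in K[ε] and e ∈ ℕ such that
  -- (A ⊗ B ⊗ C) S = ε^e T + ε^(e+1) T' for some tensor T' over K[ε].
  record _⊴_ {a b d a' b' d'} (T : Tensor a b d) (S : Tensor a' b' d')
         : Set (c ⊔ ℓ) where
    field
      A : PolyMat a a'
      B : PolyMat b b'
      C : PolyMat d d'
      A-poly : IsPolynomial A
      B-poly : IsPolynomial B
      C-poly : IsPolynomial C
      e : ℕ
      below : ∀ m → m < e → ∀ i j k → coeff A B C S m i j k ≈ 0#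
      lead  : ∀ i j k → coeff A B C S e i j k ≈ T i j k

-- Over K[[ε]], with weights s = (1 − qε, −1, ε, …, ε) and vectors a₀ = e₀,
-- a₁ = e₀ + ε²(e₁ + ⋯ + e_q), a_{i+1} = e₀ + ε eᵢ, one has
-- Σ_l s_l a_l ⊗ a_l ⊗ a_l = ε³ cw_q + O(ε⁴). Taking Kronecker powers over the words w of
-- length n in the letters 0, …, q + 1, the rows a_w, a_w, s_w a_w applied to the unit
-- tensor ⟨(q+2)ⁿ⟩ give ε^{3n} cw_q^⊗n + O(ε^{3n+1}).
--
-- The slice ⟨1, m, 1⟩, m = (q+2)ⁿ − 2(q+1)ⁿ + qⁿ, is indexed by the words σ containing
-- both letters 0 and 1. Per letter there are dual vectors λ_x, μ_y with
-- Σ_l s_l λ_x(l) μ_y(l) = ε δ_xy + O(ε²) and with λ₀, μ₁ constant; as Σ_l s_l a_l = 0,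
-- their Kronecker products satisfy Σ_w s_w λ_σ(w) a_w = 0 = Σ_w s_w μ_σ(w) a_w and
-- Σ_w s_w λ_σ(w) μ_τ(w) = εⁿ δ_στ + O(ε^{n+1}). So the x-, y- and z-rows λ_σ, μ_σ, s give the slice,
-- plus the pairing Σ_w s_w a_w(I) a_w(J); that is ε^{3n} times a matrix of rank qⁿ and is
-- cancelled exactly through ⟨1, qⁿ, 1⟩. Scaling the new rows λ_σ, μ_σ by ε^{3n+1} and the
-- rows s_w a_w by ε^{4n+2} puts both summands at order ε^{7n+2} and all cross terms higher.

module Submission where

open import Defs
open import Level using (Level; 0ℓ; _⊔_)
open import Function using (_∘_; Injective)
open import Data.Nat as ℕ using (ℕ; zero; suc; _∸_; _≤_; _<_; z≤n; s≤s)
import Data.Nat.Properties as ℕP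
open import Data.Fin as Fin using (Fin; zero; suc; splitAt; remQuot; combine; _↑ˡ_; _↑ʳ_; join)
import Data.Fin.Properties as FinP
open import Data.Sum using (_⊎_; inj₁; inj₂; [_,_]′)
open import Data.Product using (Σ; _×_; _,_; proj₁; proj₂; uncurry)
open import Data.Empty using (⊥)
open import Relation.Nullary using (yes; no; contradiction)
import Data.Nat.Solver
import Relation.Binary.Reasoning.Setoid as ≈-Reasoning
open import Relation.Binary.PropositionalEquality as ≡ using (_≡_; _≢_)
open import Data.Maybe using (Maybe; just; nothing)
open import Algebra.Bundles using (CommutativeRing; RawRing)
open import Algebra.Solver.Ring.AlmostCommutativeRing using (fromCommutativeRing; _-Raw-AlmostCommutative⟶_)

module FiniteSums {c ℓ : Level} (R : CommutativeRing c ℓ) where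
  open CommutativeRing R hiding (zero)
  open Tensors R using (ΣFin; δ)
  open import Algebra.Properties.CommutativeSemigroup +-commutativeSemigroup using (interchange)
  open ≈-Reasoning setoid

  ΣFin-cong : ∀ n {f g : Fin n → Carrier} → (∀ i → f i ≈ g i) → ΣFin n f ≈ ΣFin n g
  ΣFin-cong zero    f≈g = refl
  ΣFin-cong (suc n) f≈g = +-cong (f≈g zero) (ΣFin-cong n (f≈g ∘ suc))

  ΣFin-zero : ∀ n {f : Fin n → Carrier} → (∀ i → f i ≈ 0#) → ΣFin n f ≈ 0#
  ΣFin-zero zero    f≈0 = refl
  ΣFin-zero (suc n) f≈0 = trans (+-cong (f≈0 zero) (ΣFin-zero n (f≈0 ∘ suc))) (+-identityˡ 0#)

  ΣFin-single : ∀ n (i : Fin n) (f : Fin n → Carrier) → (∀ j → j ≢ i → f j ≈ 0#) → ΣFin n f ≈ f i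
  ΣFin-single (suc n) zero    f f≈0 =
    trans (+-congˡ (ΣFin-zero n (λ j → f≈0 (suc j) λ ()))) (+-identityʳ _)
  ΣFin-single (suc n) (suc i) f f≈0 =
    trans (+-congʳ (f≈0 zero λ ())) (trans (+-identityˡ _)
      (ΣFin-single n i (f ∘ suc) (λ j j≢i → f≈0 (suc j) (j≢i ∘ FinP.suc-injective))))

  ΣFin-distrib-+ : ∀ n (f g : Fin n → Carrier) → ΣFin n (λ i → f i + g i) ≈ ΣFin n f + ΣFin n g
  ΣFin-distrib-+ zero    f g = sym (+-identityˡ 0#)
  ΣFin-distrib-+ (suc n) f g =
    trans (+-congˡ (ΣFin-distrib-+ n (f ∘ suc) (g ∘ suc))) (interchange _ _ _ _)

  *-distribˡ-ΣFin : ∀ n x (f : Fin n → Carrier) → x * ΣFin n f ≈ ΣFin n (λ i → x * f i)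
  *-distribˡ-ΣFin zero    x f = zeroʳ x
  *-distribˡ-ΣFin (suc n) x f = trans (distribˡ x _ _) (+-congˡ (*-distribˡ-ΣFin n x (f ∘ suc)))

  *-distribʳ-ΣFin : ∀ n x (f : Fin n → Carrier) → ΣFin n f * x ≈ ΣFin n (λ i → f i * x)
  *-distribʳ-ΣFin zero    x f = zeroˡ x
  *-distribʳ-ΣFin (suc n) x f = trans (distribʳ x _ _) (+-congˡ (*-distribʳ-ΣFin n x (f ∘ suc)))

  ΣFin-splitAt : ∀ m n (f : Fin (m ℕ.+ n) → Carrier) →
                 ΣFin (m ℕ.+ n) f ≈ ΣFin m (λ i → f (i ↑ˡ n)) + ΣFin n (λ j → f (m ↑ʳ j))
  ΣFin-splitAt zero    n f = sym (+-identityˡ _)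
  ΣFin-splitAt (suc m) n f = trans (+-congˡ (ΣFin-splitAt m n (f ∘ suc))) (sym (+-assoc _ _ _))

  ΣFin-↑ˡ : ∀ m n (f : Fin (m ℕ.+ n) → Carrier) → (∀ j → f (m ↑ʳ j) ≈ 0#) →
            ΣFin (m ℕ.+ n) f ≈ ΣFin m (λ i → f (i ↑ˡ n))
  ΣFin-↑ˡ m n f f≈0 = trans (ΣFin-splitAt m n f) (trans (+-congˡ (ΣFin-zero n f≈0)) (+-identityʳ _))

  ΣFin-↑ʳ : ∀ m n (f : Fin (m ℕ.+ n) → Carrier) → (∀ i → f (i ↑ˡ n) ≈ 0#) →
            ΣFin (m ℕ.+ n) f ≈ ΣFin n (λ j → f (m ↑ʳ j))
  ΣFin-↑ʳ m n f f≈0 = trans (ΣFin-splitAt m n f) (trans (+-congʳ (ΣFin-zero m f≈0)) (+-identityˡ _))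

  ΣFin-combine : ∀ m n (f : Fin (m ℕ.* n) → Carrier) →
                 ΣFin (m ℕ.* n) f ≈ ΣFin m (λ i → ΣFin n (λ j → f (combine i j)))
  ΣFin-combine zero    n f = refl
  ΣFin-combine (suc m) n f =
    trans (ΣFin-splitAt n (m ℕ.* n) f) (+-congˡ (ΣFin-combine m n (λ x → f (n ↑ʳ x))))

  ΣFin-product : ∀ m n {h : Fin (m ℕ.* n) → Carrier} (f : Fin m → Carrier) (g : Fin n → Carrier) →
                 (∀ i j → h (combine i j) ≈ f i * g j) → ΣFin (m ℕ.* n) h ≈ ΣFin m f * ΣFin n g
  ΣFin-product m n {h} f g h≈fg = begin
    ΣFin (m ℕ.* n) h                                 ≈⟨ ΣFin-combine m n h ⟩
    ΣFin m (λ i → ΣFin n (λ j → h (combine i j)))    ≈⟨ ΣFin-cong m (λ i → ΣFin-cong n (h≈fg i)) ⟩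
    ΣFin m (λ i → ΣFin n (λ j → f i * g j))          ≈⟨ ΣFin-cong m (λ i → *-distribˡ-ΣFin n (f i) g) ⟨
    ΣFin m (λ i → f i * ΣFin n g)                    ≈⟨ *-distribʳ-ΣFin m (ΣFin n g) f ⟨
    ΣFin m f * ΣFin n g                              ∎

  δ-refl : ∀ {n} (i : Fin n) → δ i i ≈ 1#
  δ-refl i with i Fin.≟ i
  ... | yes _  = refl
  ... | no i≢i = contradiction ≡.refl i≢i

  δ-≢ : ∀ {n} {i j : Fin n} → i ≢ j → δ i j ≈ 0#
  δ-≢ {i = i} {j} i≢j with i Fin.≟ j
  ... | yes i≡j = contradiction i≡j i≢j
  ... | no _    = refl

  δ-sym : ∀ {n} (i j : Fin n) → δ i j ≈ δ j i
  δ-sym i j with i Fin.≟ j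
  ... | yes ≡.refl = sym (δ-refl i)
  ... | no i≢j     = sym (δ-≢ (i≢j ∘ ≡.sym))

  δ-injective : ∀ {m n} (h : Fin m → Fin n) → Injective _≡_ _≡_ h → ∀ i j → δ (h i) (h j) ≈ δ i j
  δ-injective h h-inj i j with i Fin.≟ j
  ... | yes ≡.refl = δ-refl (h i)
  ... | no i≢j     = δ-≢ (i≢j ∘ h-inj)

  δ-combine : ∀ {m n} (i k : Fin m) (j l : Fin n) → δ (combine i j) (combine k l) ≈ δ i k * δ j l
  δ-combine i k j l with i Fin.≟ k | j Fin.≟ l
  ... | yes ≡.refl | yes ≡.refl = trans (δ-refl (combine i j)) (sym (*-identityˡ 1#))
  ... | no i≢k     | _          = trans (δ-≢ (i≢k ∘ FinP.combine-injectiveˡ i j k l)) (sym (zeroˡ _))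
  ... | yes _      | no j≢l     = trans (δ-≢ (j≢l ∘ FinP.combine-injectiveʳ i j k l)) (sym (zeroʳ _))

  ΣFin-δ : ∀ n (i : Fin n) (f : Fin n → Carrier) → ΣFin n (λ j → δ i j * f j) ≈ f i
  ΣFin-δ n i f =
    trans (ΣFin-single n i _ (λ j j≢i → trans (*-congʳ (δ-≢ (j≢i ∘ ≡.sym))) (zeroˡ _)))
          (trans (*-congʳ (δ-refl i)) (*-identityˡ _))

module TruncatedSums {c ℓ : Level} (R : CommutativeRing c ℓ) where
  open CommutativeRing R hiding (zero)
  open Tensors R using (ΣFin; Σ≤)
  open FiniteSums R using (ΣFin-distrib-+)
  open import Algebra.Properties.CommutativeSemigroup +-commutativeSemigroup using (interchange)
  open ≈-Reasoning setoid

  Σ≤-cong-≤ : ∀ m {f g : ℕ → Carrier} → (∀ p → p ≤ m → f p ≈ g p) → Σ≤ m f ≈ Σ≤ m g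
  Σ≤-cong-≤ zero    f≈g = f≈g 0 z≤n
  Σ≤-cong-≤ (suc m) f≈g = +-cong (f≈g 0 z≤n) (Σ≤-cong-≤ m (λ p p≤m → f≈g (suc p) (s≤s p≤m)))

  Σ≤-cong : ∀ m {f g : ℕ → Carrier} → (∀ p → f p ≈ g p) → Σ≤ m f ≈ Σ≤ m g
  Σ≤-cong m f≈g = Σ≤-cong-≤ m (λ p _ → f≈g p)

  Σ≤-zero : ∀ m {f : ℕ → Carrier} → (∀ p → p ≤ m → f p ≈ 0#) → Σ≤ m f ≈ 0#
  Σ≤-zero zero    f≈0 = f≈0 0 z≤n
  Σ≤-zero (suc m) f≈0 =
    trans (+-cong (f≈0 0 z≤n) (Σ≤-zero m (λ p p≤m → f≈0 (suc p) (s≤s p≤m)))) (+-identityˡ 0#)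

  Σ≤-distrib-+ : ∀ m (f g : ℕ → Carrier) → Σ≤ m (λ p → f p + g p) ≈ Σ≤ m f + Σ≤ m g
  Σ≤-distrib-+ zero    f g = refl
  Σ≤-distrib-+ (suc m) f g =
    trans (+-congˡ (Σ≤-distrib-+ m (f ∘ suc) (g ∘ suc))) (interchange _ _ _ _)

  *-distribˡ-Σ≤ : ∀ m x (f : ℕ → Carrier) → x * Σ≤ m f ≈ Σ≤ m (λ p → x * f p)
  *-distribˡ-Σ≤ zero    x f = refl
  *-distribˡ-Σ≤ (suc m) x f = trans (distribˡ x _ _) (+-congˡ (*-distribˡ-Σ≤ m x (f ∘ suc)))

  *-distribʳ-Σ≤ : ∀ m x (f : ℕ → Carrier) → Σ≤ m f * x ≈ Σ≤ m (λ p → f p * x)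
  *-distribʳ-Σ≤ zero    x f = refl
  *-distribʳ-Σ≤ (suc m) x f = trans (distribʳ x _ _) (+-congˡ (*-distribʳ-Σ≤ m x (f ∘ suc)))

  Σ≤-snoc : ∀ m (f : ℕ → Carrier) → Σ≤ (suc m) f ≈ Σ≤ m f + f (suc m)
  Σ≤-snoc zero    f = refl
  Σ≤-snoc (suc m) f = trans (+-congˡ (Σ≤-snoc m (f ∘ suc))) (sym (+-assoc _ _ _))

  Σ≤-reverse : ∀ m (f : ℕ → Carrier) → Σ≤ m f ≈ Σ≤ m (λ p → f (m ∸ p))
  Σ≤-reverse zero    f = refl
  Σ≤-reverse (suc m) f = begin
    f 0 + Σ≤ m (f ∘ suc)                           ≈⟨ +-congˡ (Σ≤-reverse m (f ∘ suc)) ⟩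
    f 0 + Σ≤ m (λ p → f (suc (m ∸ p)))             ≈⟨ +-comm _ _ ⟩
    Σ≤ m (λ p → f (suc (m ∸ p))) + f 0
      ≈⟨ +-cong (Σ≤-cong-≤ m (λ p p≤m → reflexive (≡.cong f (≡.sym (ℕP.+-∸-assoc 1 p≤m)))))
                (reflexive (≡.cong f (≡.sym (ℕP.n∸n≡0 m)))) ⟩
    Σ≤ m (λ p → f (suc m ∸ p)) + f (suc m ∸ suc m) ≈⟨ Σ≤-snoc m (λ p → f (suc m ∸ p)) ⟨
    Σ≤ (suc m) (λ p → f (suc m ∸ p))               ∎

  Σ≤-triangle : ∀ m (G : ℕ → ℕ → Carrier) →
                Σ≤ m (λ k → Σ≤ k (λ p → G p k)) ≈ Σ≤ m (λ p → Σ≤ (m ∸ p) (λ r → G p (p ℕ.+ r)))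
  Σ≤-triangle zero    G = refl
  Σ≤-triangle (suc m) G = begin
    G 0 0 + Σ≤ m (λ k → G 0 (suc k) + Σ≤ k (λ p → G (suc p) (suc k)))
      ≈⟨ +-congˡ (Σ≤-distrib-+ m _ _) ⟩
    G 0 0 + (Σ≤ m (λ k → G 0 (suc k)) + Σ≤ m (λ k → Σ≤ k (λ p → G (suc p) (suc k))))
      ≈⟨ +-congˡ (+-congˡ (Σ≤-triangle m (λ p k → G (suc p) (suc k)))) ⟩
    G 0 0 + (Σ≤ m (λ k → G 0 (suc k)) + Σ≤ m (λ p → Σ≤ (m ∸ p) (λ r → G (suc p) (suc (p ℕ.+ r)))))
      ≈⟨ +-assoc _ _ _ ⟨
    (G 0 0 + Σ≤ m (λ k → G 0 (suc k))) + Σ≤ m (λ p → Σ≤ (m ∸ p) (λ r → G (suc p) (suc (p ℕ.+ r))))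
      ∎

  Σ≤-ΣFin-comm : ∀ m n (F : ℕ → Fin n → Carrier) →
                 Σ≤ m (λ p → ΣFin n (F p)) ≈ ΣFin n (λ i → Σ≤ m (λ p → F p i))
  Σ≤-ΣFin-comm zero    n F = refl
  Σ≤-ΣFin-comm (suc m) n F =
    trans (+-congˡ (Σ≤-ΣFin-comm m n (F ∘ suc))) (sym (ΣFin-distrib-+ n _ _))

module FormalPowerSeries {c ℓ : Level} (K : CommutativeRing c ℓ) where
  open CommutativeRing K hiding (zero)
  open Tensors K using (ΣFin; Σ≤)
  open TruncatedSums K
  open import Algebra.Properties.Ring ring using (-0#≈0#)
  open ≈-Reasoning setoid

  Series : Set c
  Series = ℕ → Carrier

  infix 4 _≈ₛ_
  record _≈ₛ_ (f g : Series) : Set ℓ where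
    constructor coefficientwise
    field at : ∀ m → f m ≈ g m
  open _≈ₛ_ public

  infixl 6 _+ₛ_
  infixl 7 _*ₛ_
  infix  8 -ₛ_

  _+ₛ_ : Series → Series → Series
  (f +ₛ g) m = f m + g m

  -ₛ_ : Series → Series
  (-ₛ f) m = - f m

  const : Carrier → Series
  const x zero    = x
  const x (suc _) = 0#

  0ₛ 1ₛ ε : Series
  0ₛ _ = 0#
  1ₛ = const 1#
  ε zero          = 0#
  ε (suc zero)    = 1#
  ε (suc (suc _)) = 0#

  opaque
    _*ₛ_ : Series → Series → Series
    (f *ₛ g) m = Σ≤ m (λ p → f p * g (m ∸ p))

    *ₛ-coeff : ∀ f g m → (f *ₛ g) m ≈ Σ≤ m (λ p → f p * g (m ∸ p))
    *ₛ-coeff f g m = refl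

    *ₛ-cong : ∀ {f f′ g g′} → f ≈ₛ f′ → g ≈ₛ g′ → f *ₛ g ≈ₛ f′ *ₛ g′
    *ₛ-cong f≈f′ g≈g′ = coefficientwise λ m → Σ≤-cong m (λ p → *-cong (at f≈f′ p) (at g≈g′ (m ∸ p)))

    *ₛ-comm : ∀ f g → f *ₛ g ≈ₛ g *ₛ f
    *ₛ-comm f g = coefficientwise λ m → begin
      Σ≤ m (λ p → f p * g (m ∸ p))             ≈⟨ Σ≤-reverse m _ ⟩
      Σ≤ m (λ p → f (m ∸ p) * g (m ∸ (m ∸ p)))
        ≈⟨ Σ≤-cong-≤ m (λ p p≤m → trans (*-congˡ (reflexive (≡.cong g (ℕP.m∸[m∸n]≡n p≤m)))) (*-comm _ _)) ⟩
      Σ≤ m (λ p → g p * f (m ∸ p))             ∎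

    *ₛ-assoc : ∀ f g h → (f *ₛ g) *ₛ h ≈ₛ f *ₛ (g *ₛ h)
    *ₛ-assoc f g h = coefficientwise λ m → begin
      Σ≤ m (λ k → Σ≤ k (λ p → f p * g (k ∸ p)) * h (m ∸ k))
        ≈⟨ Σ≤-cong m (λ k → *-distribʳ-Σ≤ k _ _) ⟩
      Σ≤ m (λ k → Σ≤ k (λ p → f p * g (k ∸ p) * h (m ∸ k)))
        ≈⟨ Σ≤-triangle m (λ p k → f p * g (k ∸ p) * h (m ∸ k)) ⟩
      Σ≤ m (λ p → Σ≤ (m ∸ p) (λ r → f p * g ((p ℕ.+ r) ∸ p) * h (m ∸ (p ℕ.+ r))))
        ≈⟨ Σ≤-cong m (λ p → Σ≤-cong (m ∸ p) (λ r → trans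
             (*-cong (*-congˡ (reflexive (≡.cong g (ℕP.m+n∸m≡n p r))))
                     (reflexive (≡.cong h (≡.sym (ℕP.∸-+-assoc m p r)))))
             (*-assoc _ _ _))) ⟩
      Σ≤ m (λ p → Σ≤ (m ∸ p) (λ r → f p * (g r * h ((m ∸ p) ∸ r))))
        ≈⟨ Σ≤-cong m (λ p → *-distribˡ-Σ≤ (m ∸ p) (f p) _) ⟨
      Σ≤ m (λ p → f p * Σ≤ (m ∸ p) (λ r → g r * h ((m ∸ p) ∸ r)))
        ∎

    const-*ₛ-coeff : ∀ x f m → (const x *ₛ f) m ≈ x * f m
    const-*ₛ-coeff x f zero    = refl
    const-*ₛ-coeff x f (suc m) = trans (+-congˡ (Σ≤-zero m (λ p _ → zeroˡ _))) (+-identityʳ _)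

    *ₛ-distribˡ : ∀ f g h → f *ₛ (g +ₛ h) ≈ₛ f *ₛ g +ₛ f *ₛ h
    *ₛ-distribˡ f g h = coefficientwise λ m → trans (Σ≤-cong m (λ p → distribˡ (f p) _ _)) (Σ≤-distrib-+ m _ _)

    ε-*ₛ-coeff-0 : ∀ f → (ε *ₛ f) 0 ≈ 0#
    ε-*ₛ-coeff-0 f = zeroˡ _

    ε-*ₛ-coeff-suc : ∀ f m → (ε *ₛ f) (suc m) ≈ f m
    ε-*ₛ-coeff-suc f zero    = trans (+-cong (zeroˡ _) (*-identityˡ _)) (+-identityˡ _)
    ε-*ₛ-coeff-suc f (suc m) = begin
      0# * f (suc (suc m)) + (1# * f (suc m) + Σ≤ m (λ p → 0# * f (m ∸ p)))
        ≈⟨ +-cong (zeroˡ _) (+-cong (*-identityˡ _) (Σ≤-zero m (λ p _ → zeroˡ _))) ⟩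
      0# + (f (suc m) + 0#) ≈⟨ trans (+-identityˡ _) (+-identityʳ _) ⟩
      f (suc m)             ∎

  *ₛ-identityˡ : ∀ f → 1ₛ *ₛ f ≈ₛ f
  *ₛ-identityˡ f = coefficientwise λ m → trans (const-*ₛ-coeff 1# f m) (*-identityˡ _)

  seriesRing : CommutativeRing c ℓ
  seriesRing = record
    { Carrier = Series
    ; _≈_ = _≈ₛ_
    ; _+_ = _+ₛ_
    ; _*_ = _*ₛ_
    ; -_ = -ₛ_
    ; 0# = 0ₛ
    ; 1# = 1ₛ
    ; isCommutativeRing = record
      { isRing = record
        { +-isAbelianGroup = record
          { isGroup = record
            { isMonoid = record
              { isSemigroup = record
                { isMagma = record
                  { isEquivalence = record
                    { refl  = coefficientwise λ _ → refl
                    ; sym   = λ f≈g → coefficientwise λ m → sym (at f≈g m)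
                    ; trans = λ f≈g g≈h → coefficientwise λ m → trans (at f≈g m) (at g≈h m) }
                  ; ∙-cong = λ f≈f′ g≈g′ → coefficientwise λ m → +-cong (at f≈f′ m) (at g≈g′ m) }
                ; assoc = λ f g h → coefficientwise λ m → +-assoc (f m) (g m) (h m) }
              ; identity = (λ f → coefficientwise λ m → +-identityˡ (f m))
                         , (λ f → coefficientwise λ m → +-identityʳ (f m)) }
            ; inverse = (λ f → coefficientwise λ m → -‿inverseˡ (f m))
                      , (λ f → coefficientwise λ m → -‿inverseʳ (f m))
            ; ⁻¹-cong = λ f≈g → coefficientwise λ m → -‿cong (at f≈g m) }
          ; comm = λ f g → coefficientwise λ m → +-comm (f m) (g m) }
        ; *-cong = *ₛ-cong
        ; *-assoc = *ₛ-assoc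
        ; *-identity = *ₛ-identityˡ
                     , (λ f → coefficientwise λ m → trans (at (*ₛ-comm f 1ₛ) m) (at (*ₛ-identityˡ f) m))
        ; distrib = *ₛ-distribˡ
                  , (λ f g h → coefficientwise λ m → begin
                       ((g +ₛ h) *ₛ f) m        ≈⟨ at (*ₛ-comm (g +ₛ h) f) m ⟩
                       (f *ₛ (g +ₛ h)) m        ≈⟨ at (*ₛ-distribˡ f g h) m ⟩
                       (f *ₛ g +ₛ f *ₛ h) m     ≈⟨ +-cong (at (*ₛ-comm f g) m) (at (*ₛ-comm f h) m) ⟩
                       (g *ₛ f +ₛ h *ₛ f) m     ∎) }
      ; *-comm = *ₛ-comm }
    }

  module S = CommutativeRing seriesRing

  infix 9 ε^_
  ε^_ : ℕ → Series
  ε^ zero  = 1ₛ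
  ε^ suc k = ε *ₛ ε^ k

  ε^-+ : ∀ a b → ε^ (a ℕ.+ b) ≈ₛ ε^ a *ₛ ε^ b
  ε^-+ zero    b = S.sym (*ₛ-identityˡ _)
  ε^-+ (suc a) b = S.trans (S.*-congˡ (ε^-+ a b)) (S.sym (*ₛ-assoc ε (ε^ a) (ε^ b)))

  ε^-*ₛ-coeff-< : ∀ k f {m} → m < k → (ε^ k *ₛ f) m ≈ 0#
  ε^-*ₛ-coeff-< (suc k) f {zero}  _         = trans (at (*ₛ-assoc ε (ε^ k) f) 0) (ε-*ₛ-coeff-0 _)
  ε^-*ₛ-coeff-< (suc k) f {suc m} (s≤s m<k) =
    trans (at (*ₛ-assoc ε (ε^ k) f) (suc m)) (trans (ε-*ₛ-coeff-suc _ m) (ε^-*ₛ-coeff-< k f m<k))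

  ε^-*ₛ-coeff-+ : ∀ k f m → (ε^ k *ₛ f) (k ℕ.+ m) ≈ f m
  ε^-*ₛ-coeff-+ zero    f m = at (*ₛ-identityˡ f) m
  ε^-*ₛ-coeff-+ (suc k) f m =
    trans (at (*ₛ-assoc ε (ε^ k) f) (suc (k ℕ.+ m))) (trans (ε-*ₛ-coeff-suc _ _) (ε^-*ₛ-coeff-+ k f m))

  const-cong : ∀ {x y} → x ≈ y → const x ≈ₛ const y
  const-cong x≈y = coefficientwise λ { zero → x≈y ; (suc _) → refl }

  const-0# : const 0# ≈ₛ 0ₛ
  const-0# = coefficientwise λ { zero → refl ; (suc _) → refl }

  const-* : ∀ x y → const (x * y) ≈ₛ const x *ₛ const y
  const-* x y = coefficientwise λ m → sym (trans (const-*ₛ-coeff x (const y) m) (lemma m))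
    where
    lemma : ∀ m → x * const y m ≈ const (x * y) m
    lemma zero    = refl
    lemma (suc m) = zeroʳ x

  ΣFin-coeff : ∀ n (F : Fin n → Series) m → Tensors.ΣFin seriesRing n F m ≈ ΣFin n (λ i → F i m)
  ΣFin-coeff zero    F m = refl
  ΣFin-coeff (suc n) F m = +-congˡ (ΣFin-coeff n (F ∘ suc) m)

  triple-product-coeff : ∀ f g h x m →
    Σ≤ m (λ p → Σ≤ (m ∸ p) (λ p′ → f p * g p′ * h ((m ∸ p) ∸ p′) * x)) ≈ (f *ₛ (g *ₛ (const x *ₛ h))) m
  triple-product-coeff f g h x m = begin
    Σ≤ m (λ p → Σ≤ (m ∸ p) (λ p′ → f p * g p′ * h ((m ∸ p) ∸ p′) * x))
      ≈⟨ Σ≤-cong m (λ p → Σ≤-cong (m ∸ p) (λ p′ →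
           trans (*-assoc _ _ _) (trans (*-assoc _ _ _) (*-congˡ (*-congˡ (*-comm _ _)))))) ⟩
    Σ≤ m (λ p → Σ≤ (m ∸ p) (λ p′ → f p * (g p′ * (x * h ((m ∸ p) ∸ p′)))))
      ≈⟨ Σ≤-cong m (λ p → Σ≤-cong (m ∸ p) (λ p′ → *-congˡ (*-congˡ (const-*ₛ-coeff x h _)))) ⟨
    Σ≤ m (λ p → Σ≤ (m ∸ p) (λ p′ → f p * (g p′ * (const x *ₛ h) ((m ∸ p) ∸ p′))))
      ≈⟨ Σ≤-cong m (λ p → *-distribˡ-Σ≤ (m ∸ p) (f p) _) ⟨
    Σ≤ m (λ p → f p * Σ≤ (m ∸ p) (λ p′ → g p′ * (const x *ₛ h) ((m ∸ p) ∸ p′)))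
      ≈⟨ Σ≤-cong m (λ p → *-congˡ (*ₛ-coeff g (const x *ₛ h) (m ∸ p))) ⟨
    Σ≤ m (λ p → f p * (g *ₛ (const x *ₛ h)) (m ∸ p))
      ≈⟨ *ₛ-coeff f _ m ⟨
    (f *ₛ (g *ₛ (const x *ₛ h))) m ∎

  Deg≤ : ℕ → Series → Set ℓ
  Deg≤ D f = ∀ p → D < p → f p ≈ 0#

  Deg≤-mono : ∀ {D D′ f} → D ≤ D′ → Deg≤ D f → Deg≤ D′ f
  Deg≤-mono D≤D′ f≤D p D′<p = f≤D p (ℕP.≤-<-trans D≤D′ D′<p)

  Deg≤-+ : ∀ {D f g} → Deg≤ D f → Deg≤ D g → Deg≤ D (f +ₛ g)
  Deg≤-+ f≤D g≤D p D<p = trans (+-cong (f≤D p D<p) (g≤D p D<p)) (+-identityˡ 0#)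

  Deg≤--ₛ : ∀ {D f} → Deg≤ D f → Deg≤ D (-ₛ f)
  Deg≤--ₛ f≤D p D<p = trans (-‿cong (f≤D p D<p)) -0#≈0#

  Deg≤-0ₛ : ∀ D → Deg≤ D 0ₛ
  Deg≤-0ₛ D p D<p = refl

  Deg≤-const : ∀ D x → Deg≤ D (const x)
  Deg≤-const D x (suc p) D<p = refl

  Deg≤-ε : Deg≤ 1 ε
  Deg≤-ε (suc zero)    (s≤s ())
  Deg≤-ε (suc (suc p)) _ = refl

  Deg≤-*ₛ : ∀ {D E f g} → Deg≤ D f → Deg≤ E g → Deg≤ (D ℕ.+ E) (f *ₛ g)
  Deg≤-*ₛ {D} {E} {f} {g} f≤D g≤E p D+E<p = trans (*ₛ-coeff f g p) (Σ≤-zero p term)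
    where
    term : ∀ t → t ≤ p → f t * g (p ∸ t) ≈ 0#
    term t t≤p with D ℕP.<? t
    ... | yes D<t = trans (*-congʳ (f≤D t D<t)) (zeroˡ _)
    ... | no  D≮t = trans (*-congˡ (g≤E (p ∸ t) E<p∸t)) (zeroʳ _)
      where
      E<p∸t : E < p ∸ t
      E<p∸t = ℕP.m+n≤o⇒m≤o∸n (suc E) (ℕP.≤-trans (ℕP.+-monoʳ-≤ (suc E) (ℕP.≮⇒≥ D≮t))
                (ℕP.≤-trans (ℕP.≤-reflexive (≡.cong suc (ℕP.+-comm E D))) D+E<p))

  Deg≤-ε^ : ∀ k → Deg≤ k (ε^ k)
  Deg≤-ε^ zero    = Deg≤-const 0 1#
  Deg≤-ε^ (suc k) = Deg≤-*ₛ Deg≤-ε (Deg≤-ε^ k)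

  Deg≤-ΣFin : ∀ {D} n (F : Fin n → Series) → (∀ i → Deg≤ D (F i)) → Deg≤ D (Tensors.ΣFin seriesRing n F)
  Deg≤-ΣFin zero    F F≤D = Deg≤-0ₛ _
  Deg≤-ΣFin (suc n) F F≤D = Deg≤-+ (F≤D zero) (Deg≤-ΣFin n (F ∘ suc) (F≤D ∘ suc))

module IntegerCoefficientSolver {c ℓ : Level} (R : CommutativeRing c ℓ) where
  open CommutativeRing R
  open import Algebra.Properties.Ring ring
    using (-‿+-comm; -‿involutive; -‿distribˡ-*; -‿distribʳ-*; -0#≈0#)
  open import Algebra.Properties.Semiring.Mult semiring using (×-homo-+; ×1-homo-*) renaming (_×_ to _·_)
  import Algebra.Solver.Ring.NaturalCoefficients.Default commutativeSemiring as ℕ-Solver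
  open ℕ-Solver using (_:+_; _:*_; _:=_)
  open ≈-Reasoning setoid

  -- (a , b) represents the integer a − b.
  differences : RawRing 0ℓ 0ℓ
  differences = record
    { Carrier = ℕ × ℕ
    ; _≈_ = λ (a , b) (c , d) → a ℕ.+ d ≡ c ℕ.+ b
    ; _+_ = λ (a , b) (c , d) → (a ℕ.+ c , b ℕ.+ d)
    ; _*_ = λ (a , b) (c , d) → (a ℕ.* c ℕ.+ b ℕ.* d , a ℕ.* d ℕ.+ b ℕ.* c)
    ; -_  = λ (a , b) → (b , a)
    ; 0#  = (0 , 0)
    ; 1#  = (1 , 0)
    }

  ⌜_⌝ : ℕ → Carrier
  ⌜ n ⌝ = n · 1#

  -- The special cases make the constants con (0 , 0) and con (1 , 0) of
  -- solver expressions denote 0# and 1# on the nose.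
  ⟦_⟧ℤ : ℕ × ℕ → Carrier
  ⟦ 0 , 0 ⟧ℤ = 0#
  ⟦ 1 , 0 ⟧ℤ = 1#
  ⟦ a , b ⟧ℤ = ⌜ a ⌝ + - ⌜ b ⌝

  ⟦⟧ℤ-difference : ∀ a b → ⟦ a , b ⟧ℤ ≈ ⌜ a ⌝ + - ⌜ b ⌝
  ⟦⟧ℤ-difference 0             0             = sym (trans (+-congˡ -0#≈0#) (+-identityʳ 0#))
  ⟦⟧ℤ-difference 1             0             = sym (trans (+-congˡ -0#≈0#) (trans (+-identityʳ _) (+-identityʳ 1#)))
  ⟦⟧ℤ-difference 0             (suc b)       = refl
  ⟦⟧ℤ-difference 1             (suc b)       = refl
  ⟦⟧ℤ-difference (suc (suc a)) b             = refl

  +-homo : ∀ a b c d → ⟦ a ℕ.+ c , b ℕ.+ d ⟧ℤ ≈ ⟦ a , b ⟧ℤ + ⟦ c , d ⟧ℤ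
  +-homo a b c d = begin
    ⟦ a ℕ.+ c , b ℕ.+ d ⟧ℤ               ≈⟨ ⟦⟧ℤ-difference (a ℕ.+ c) (b ℕ.+ d) ⟩
    ⌜ a ℕ.+ c ⌝ + - ⌜ b ℕ.+ d ⌝          ≈⟨ +-cong (×-homo-+ 1# a c) (-‿cong (×-homo-+ 1# b d)) ⟩
    (⌜ a ⌝ + ⌜ c ⌝) + - (⌜ b ⌝ + ⌜ d ⌝)  ≈⟨ +-congˡ (-‿+-comm ⌜ b ⌝ ⌜ d ⌝) ⟨
    (⌜ a ⌝ + ⌜ c ⌝) + (- ⌜ b ⌝ + - ⌜ d ⌝)
      ≈⟨ ℕ-Solver.solve 4 (λ A C B D → (A :+ C) :+ (B :+ D) := (A :+ B) :+ (C :+ D)) refl _ _ _ _ ⟩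
    (⌜ a ⌝ + - ⌜ b ⌝) + (⌜ c ⌝ + - ⌜ d ⌝) ≈⟨ +-cong (⟦⟧ℤ-difference a b) (⟦⟧ℤ-difference c d) ⟨
    ⟦ a , b ⟧ℤ + ⟦ c , d ⟧ℤ                ∎

  *-homo : ∀ a b c d → ⟦ a ℕ.* c ℕ.+ b ℕ.* d , a ℕ.* d ℕ.+ b ℕ.* c ⟧ℤ ≈ ⟦ a , b ⟧ℤ * ⟦ c , d ⟧ℤ
  *-homo a b c d = begin
    ⟦ a ℕ.* c ℕ.+ b ℕ.* d , a ℕ.* d ℕ.+ b ℕ.* c ⟧ℤ
      ≈⟨ ⟦⟧ℤ-difference (a ℕ.* c ℕ.+ b ℕ.* d) (a ℕ.* d ℕ.+ b ℕ.* c) ⟩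
    ⌜ a ℕ.* c ℕ.+ b ℕ.* d ⌝ + - ⌜ a ℕ.* d ℕ.+ b ℕ.* c ⌝
      ≈⟨ +-cong (trans (×-homo-+ 1# (a ℕ.* c) (b ℕ.* d)) (+-cong (×1-homo-* a c) (×1-homo-* b d)))
                (-‿cong (trans (×-homo-+ 1# (a ℕ.* d) (b ℕ.* c)) (+-cong (×1-homo-* a d) (×1-homo-* b c)))) ⟩
    (A * C + B * D) + - (A * D + B * C)
      ≈⟨ +-congˡ (-‿+-comm (A * D) (B * C)) ⟨
    (A * C + B * D) + (- (A * D) + - (B * C))
      ≈⟨ +-cong (+-congˡ (trans (sym (-‿involutive _)) (trans (-‿cong (-‿distribʳ-* B D)) (-‿distribˡ-* B (- D)))))
                (+-cong (-‿distribʳ-* A D) (-‿distribˡ-* B C)) ⟩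
    (A * C + - B * - D) + (A * - D + - B * C)
      ≈⟨ ℕ-Solver.solve 4 (λ A C B D → (A :* C :+ B :* D) :+ (A :* D :+ B :* C) := (A :+ B) :* (C :+ D))
                          refl A C (- B) (- D) ⟩
    (A + - B) * (C + - D)
      ≈⟨ *-cong (⟦⟧ℤ-difference a b) (⟦⟧ℤ-difference c d) ⟨
    ⟦ a , b ⟧ℤ * ⟦ c , d ⟧ℤ ∎
    where
    A = ⌜ a ⌝
    B = ⌜ b ⌝
    C = ⌜ c ⌝
    D = ⌜ d ⌝

  -‿homo : ∀ a b → ⟦ b , a ⟧ℤ ≈ - ⟦ a , b ⟧ℤ
  -‿homo a b = begin
    ⟦ b , a ⟧ℤ               ≈⟨ ⟦⟧ℤ-difference b a ⟩
    ⌜ b ⌝ + - ⌜ a ⌝         ≈⟨ +-comm _ _ ⟩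
    - ⌜ a ⌝ + ⌜ b ⌝         ≈⟨ +-congˡ (-‿involutive _) ⟨
    - ⌜ a ⌝ + - - ⌜ b ⌝     ≈⟨ -‿+-comm _ _ ⟩
    - (⌜ a ⌝ + - ⌜ b ⌝)     ≈⟨ -‿cong (⟦⟧ℤ-difference a b) ⟨
    - ⟦ a , b ⟧ℤ             ∎

  ℤ-morphism : differences -Raw-AlmostCommutative⟶ fromCommutativeRing R
  ℤ-morphism = record
    { ⟦_⟧    = ⟦_⟧ℤ
    ; +-homo = λ (a , b) (c , d) → +-homo a b c d
    ; *-homo = λ (a , b) (c , d) → *-homo a b c d
    ; -‿homo = λ (a , b) → -‿homo a b
    ; 0-homo = refl
    ; 1-homo = refl
    }

  ⟦⟧ℤ-≟ : ∀ x y → Maybe (⟦ x ⟧ℤ ≈ ⟦ y ⟧ℤ)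
  ⟦⟧ℤ-≟ (a , b) (c , d) with a ℕ.+ d ℕP.≟ c ℕ.+ b
  ... | no  _       = nothing
  ... | yes a+d≡c+b = just (begin
    ⟦ a , b ⟧ℤ                             ≈⟨ ⟦⟧ℤ-difference a b ⟩
    ⌜ a ⌝ + - ⌜ b ⌝                       ≈⟨ trans (+-congˡ (-‿inverseʳ ⌜ d ⌝)) (+-identityʳ _) ⟨
    (⌜ a ⌝ + - ⌜ b ⌝) + (⌜ d ⌝ + - ⌜ d ⌝)
      ≈⟨ ℕ-Solver.solve 4 (λ A B D E → (A :+ B) :+ (D :+ E) := (A :+ D) :+ (B :+ E)) refl _ _ _ _ ⟩
    (⌜ a ⌝ + ⌜ d ⌝) + (- ⌜ b ⌝ + - ⌜ d ⌝)
      ≈⟨ +-congʳ (trans (sym (×-homo-+ 1# a d)) (trans (reflexive (≡.cong ⌜_⌝ a+d≡c+b)) (×-homo-+ 1# c b))) ⟩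
    (⌜ c ⌝ + ⌜ b ⌝) + (- ⌜ b ⌝ + - ⌜ d ⌝)
      ≈⟨ ℕ-Solver.solve 4 (λ C B E F → (C :+ B) :+ (E :+ F) := (C :+ F) :+ (B :+ E)) refl _ _ _ _ ⟩
    (⌜ c ⌝ + - ⌜ d ⌝) + (⌜ b ⌝ + - ⌜ b ⌝) ≈⟨ trans (+-congˡ (-‿inverseʳ ⌜ b ⌝)) (+-identityʳ _) ⟩
    ⌜ c ⌝ + - ⌜ d ⌝                       ≈⟨ ⟦⟧ℤ-difference c d ⟨
    ⟦ c , d ⟧ℤ                             ∎)

  open import Algebra.Solver.Ring differences (fromCommutativeRing R) ℤ-morphism ⟦⟧ℤ-≟ public

  :0 :1 : ∀ {n} → Polynomial n
  :0 = con (0 , 0)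
  :1 = con (1 , 0)

module LeadingTerms {c ℓ : Level} (K : CommutativeRing c ℓ) where
  private module K = CommutativeRing K
  open FormalPowerSeries K
    using (Series; seriesRing; at; const; ε; ε^_; ε^-+; ε^-*ₛ-coeff-<; ε^-*ₛ-coeff-+; ε-*ₛ-coeff-0;
           const-cong; const-0#; const-*)
  open CommutativeRing seriesRing hiding (zero)
  open IntegerCoefficientSolver seriesRing using (solve; _:+_; _:*_; _:=_; :0)
  open ≈-Reasoning setoid

  infix 4 _≃_·ε^_
  record _≃_·ε^_ (f : Series) (t : K.Carrier) (e : ℕ) : Set (c ⊔ ℓ) where
    constructor _,_
    field
      rest      : Series
      expansion : f ≈ ε^ e * (const t + ε * rest)

  ≃-intro : ∀ {f t e L} r → f ≈ ε^ e * (L + ε * r) → L ≈ const t → f ≃ t ·ε^ e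
  ≃-intro r f≈ L≈ = r , trans f≈ (*-congˡ (+-congʳ L≈))

  ≈-≃-trans : ∀ {f g t e} → f ≈ g → g ≃ t ·ε^ e → f ≃ t ·ε^ e
  ≈-≃-trans f≈g (r , g≈) = r , trans f≈g g≈

  ≃-respʳ : ∀ {f t u e} → t K.≈ u → f ≃ t ·ε^ e → f ≃ u ·ε^ e
  ≃-respʳ t≈u (r , f≈) = r , trans f≈ (*-congˡ (+-congʳ (const-cong t≈u)))

  ≃-* : ∀ {f g s t a b} → f ≃ s ·ε^ a → g ≃ t ·ε^ b → f * g ≃ (s K.* t) ·ε^ (a ℕ.+ b)
  ≃-* {f} {g} {s} {t} {a} {b} (r , f≈) (r′ , g≈) = r″ , (begin
    f * g                                         ≈⟨ *-cong f≈ g≈ ⟩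
    (ε^ a * (s′ + ε * r)) * (ε^ b * (t′ + ε * r′))
      ≈⟨ solve 7 (λ A B S T E R R′ → (A :* (S :+ E :* R)) :* (B :* (T :+ E :* R′))
                    := (A :* B) :* (S :* T :+ E :* (R :* (T :+ E :* R′) :+ S :* R′)))
               refl (ε^ a) (ε^ b) s′ t′ ε r r′ ⟩
    (ε^ a * ε^ b) * (s′ * t′ + ε * r″)            ≈⟨ *-cong (ε^-+ a b) (+-congʳ (const-* s t)) ⟨
    ε^ (a ℕ.+ b) * (const (s K.* t) + ε * r″)     ∎)
    where
    s′ = const s
    t′ = const t
    r″ = r * (t′ + ε * r′) + s′ * r′

  ε^-≃ : ∀ a → ε^ a ≃ K.1# ·ε^ a
  ε^-≃ a = 0# , sym (trans (*-congˡ (trans (+-congˡ (zeroʳ ε)) (+-identityʳ _))) (*-identityʳ _))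

  ε^-*-≃ : ∀ {f t e} a → f ≃ t ·ε^ e → ε^ a * f ≃ t ·ε^ (a ℕ.+ e)
  ε^-*-≃ a f≃ = ≃-respʳ (K.*-identityˡ _) (≃-* (ε^-≃ a) f≃)

  0≃ : ∀ e → 0# ≃ K.0# ·ε^ e
  0≃ e = 0# , sym (trans (*-congˡ (trans (+-cong const-0# (zeroʳ ε)) (+-identityʳ 0#))) (zeroʳ _))

  ≃-negligible : ∀ e {a} f → e < a → ε^ a * f ≃ K.0# ·ε^ e
  ≃-negligible e {a} f e<a = ε^ b * f , (begin
    ε^ a * f                         ≡⟨ ≡.cong (λ k → ε^ k * f) (ℕP.m+[n∸m]≡n e<a) ⟨
    ε * ε^ (e ℕ.+ b) * f             ≈⟨ *-congʳ (*-congˡ (ε^-+ e b)) ⟩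
    ε * (ε^ e * ε^ b) * f
      ≈⟨ solve 4 (λ E A B F → E :* (A :* B) :* F := A :* (:0 :+ E :* (B :* F))) refl ε (ε^ e) (ε^ b) f ⟩
    ε^ e * (0# + ε * (ε^ b * f))     ≈⟨ *-congˡ (+-congʳ const-0#) ⟨
    ε^ e * (const K.0# + ε * (ε^ b * f)) ∎)
    where b = a ∸ suc e

  ≃-reindex : ∀ {f t a b} → a ≡ b → f ≃ t ·ε^ a → f ≃ t ·ε^ b
  ≃-reindex ≡.refl f≃ = f≃

  ≃-coeff-< : ∀ {f t e m} → f ≃ t ·ε^ e → m < e → f m K.≈ K.0#
  ≃-coeff-< {e = e} {m} (r , f≈) m<e = K.trans (at f≈ m) (ε^-*ₛ-coeff-< e _ m<e)

  ≃-coeff-≡ : ∀ {f t e} → f ≃ t ·ε^ e → f e K.≈ t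
  ≃-coeff-≡ {f} {t} {e} (r , f≈) = K.trans (at f≈ e) (K.trans
    (K.reflexive (≡.cong (ε^ e * (const t + ε * r)) (≡.sym (ℕP.+-identityʳ e))))
    (K.trans (ε^-*ₛ-coeff-+ e _ 0) (K.trans (K.+-congˡ (ε-*ₛ-coeff-0 r)) (K.+-identityʳ t))))

module Injections where

  splitAt-injective : ∀ m {n} → Injective _≡_ _≡_ (splitAt m {n})
  splitAt-injective m {n} {i} {j} i≡j =
    ≡.trans (≡.sym (FinP.join-splitAt m n i)) (≡.trans (≡.cong (join m n) i≡j) (FinP.join-splitAt m n j))

  remQuot-injective : ∀ {m} n → Injective _≡_ _≡_ (remQuot {m} n)
  remQuot-injective {m} n {i} {j} i≡j =
    ≡.trans (≡.sym (FinP.combine-remQuot {m} n i))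
            (≡.trans (≡.cong (uncurry combine) i≡j) (FinP.combine-remQuot {m} n j))

  [,]-injective : ∀ {a b c} {A : Set a} {B : Set b} {C : Set c} {f : A → C} {g : B → C} →
                  Injective _≡_ _≡_ f → Injective _≡_ _≡_ g → (∀ x y → f x ≢ g y) →
                  Injective _≡_ _≡_ [ f , g ]′
  [,]-injective f-inj g-inj f≢g {inj₁ x} {inj₁ y} eq = ≡.cong inj₁ (f-inj eq)
  [,]-injective f-inj g-inj f≢g {inj₁ x} {inj₂ y} eq = contradiction eq (f≢g x y)
  [,]-injective f-inj g-inj f≢g {inj₂ x} {inj₁ y} eq = contradiction (≡.sym eq) (f≢g y x)
  [,]-injective f-inj g-inj f≢g {inj₂ x} {inj₂ y} eq = ≡.cong inj₂ (g-inj eq)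

module Words (q : ℕ) where
  open Injections

  Letter : Set
  Letter = Fin (2 ℕ.+ q)

  Word : ℕ → Set
  Word n = Fin ((2 ℕ.+ q) ℕ.^ n)

  cons : ∀ n → Letter → Word n → Word (suc n)
  cons n = combine

  cons-injectiveˡ : ∀ n {a b} (v w : Word n) → cons n a v ≡ cons n b w → a ≡ b
  cons-injectiveˡ n v w = FinP.combine-injectiveˡ _ v _ w

  cons-injectiveʳ : ∀ n a {v w : Word n} → cons n a v ≡ cons n a w → v ≡ w
  cons-injectiveʳ n a = FinP.combine-injectiveʳ a _ a _

  uncons : ∀ n → Word (suc n) → Letter × Word n
  uncons n = remQuot ((2 ℕ.+ q) ℕ.^ n)

  uncons-cons : ∀ n a (w : Word n) → uncons n (cons n a w) ≡ (a , w)
  uncons-cons n = FinP.remQuot-combine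

  Occurs : Letter → ∀ n → Word n → Set
  Occurs a zero    w = ⊥
  Occurs a (suc n) w = proj₁ (uncons n w) ≡ a ⊎ Occurs a n (proj₂ (uncons n w))

  Occurs-cons : ∀ {a} n b (w : Word n) → b ≡ a ⊎ Occurs a n w → Occurs a (suc n) (cons n b w)
  Occurs-cons {a} n b w =
    ≡.subst (λ (p : Letter × Word n) → proj₁ p ≡ a ⊎ Occurs a n (proj₂ p)) (≡.sym (uncons-cons n b w))

  prefixed : ∀ {k m} n → (Fin k → Letter) → (Fin m → Word n) → Fin (k ℕ.* m) → Word (suc n)
  prefixed {m = m} n letter word = uncurry (cons n) ∘ Data.Product.map letter word ∘ remQuot m

  prefixed-injective : ∀ {k m} n {letter : Fin k → Letter} {word : Fin m → Word n} →
                       Injective _≡_ _≡_ letter → Injective _≡_ _≡_ word →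
                       Injective _≡_ _≡_ (prefixed n letter word)
  prefixed-injective {m = m} n letter-inj word-inj eq =
    let (a≡b , v≡w) = FinP.combine-injective {n = (2 ℕ.+ q) ℕ.^ n} _ _ _ _ eq
    in remQuot-injective m (≡.cong₂ _,_ (letter-inj a≡b) (word-inj v≡w))

  prefixed-≢-cons : ∀ {k m} n {a} (letter : Fin k → Letter) (word : Fin m → Word n) →
                    (∀ i → letter i ≢ a) → ∀ w t → cons n a w ≢ prefixed n letter word t
  prefixed-≢-cons {m = m} n letter word letter≢a w t eq =
    letter≢a (proj₁ (remQuot m t)) (≡.sym (cons-injectiveˡ n w _ eq))

  #containing : ℕ → ℕ
  #containing zero    = 0
  #containing (suc n) = (2 ℕ.+ q) ℕ.^ n ℕ.+ suc q ℕ.* #containing n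

  #containing01 : ℕ → ℕ
  #containing01 zero    = 0
  #containing01 (suc n) = #containing n ℕ.+ (#containing n ℕ.+ q ℕ.* #containing01 n)

  containingWord : Letter → ∀ n → Fin (#containing n) → Word n
  containingWord a (suc n) =
    [ cons n a , prefixed n (Fin.punchIn a) (containingWord a n) ]′ ∘ splitAt ((2 ℕ.+ q) ℕ.^ n)

  letter+2 : Fin q → Letter
  letter+2 i = suc (suc i)

  containing01Word : ∀ n → Fin (#containing01 n) → Word n
  containing01Word (suc n) =
    [ cons n zero ∘ containingWord (suc zero) n
    , [ cons n (suc zero) ∘ containingWord zero n
      , prefixed n letter+2 (containing01Word n)
      ]′ ∘ splitAt (#containing n)
    ]′ ∘ splitAt (#containing n)

  containingWord-injective : ∀ a n → Injective _≡_ _≡_ (containingWord a n)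
  containingWord-injective a (suc n) eq = splitAt-injective ((2 ℕ.+ q) ℕ.^ n) ([,]-injective
    (cons-injectiveʳ n a)
    (prefixed-injective n {Fin.punchIn a} (FinP.punchIn-injective a _ _) (containingWord-injective a n))
    (prefixed-≢-cons n (Fin.punchIn a) (containingWord a n) (FinP.punchInᵢ≢i a))
    eq)

  containing01Word-injective : ∀ n → Injective _≡_ _≡_ (containing01Word n)
  containing01Word-injective (suc n) eq = splitAt-injective (#containing n) ([,]-injective
    (containingWord-injective (suc zero) n ∘ cons-injectiveʳ n zero)
    (λ eq′ → splitAt-injective (#containing n) ([,]-injective
       (containingWord-injective zero n ∘ cons-injectiveʳ n (suc zero))
       (prefixed-injective n {letter+2} (FinP.suc-injective ∘ FinP.suc-injective) (containing01Word-injective n))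
       (λ u → prefixed-≢-cons n {suc zero} letter+2 (containing01Word n) (λ _ ()) (containingWord zero n u))
       eq′))
    (λ u t → zero-first-≢ (containingWord (suc zero) n u) (splitAt (#containing n) t))
    eq)
    where
    zero-first-≢ : ∀ w u → cons n zero w ≢ [ cons n (suc zero) ∘ containingWord zero n
                                           , prefixed n letter+2 (containing01Word n) ]′ u
    zero-first-≢ w (inj₁ v) eq′ with cons-injectiveˡ n {zero} {suc zero} w (containingWord zero n v) eq′
    ... | ()
    zero-first-≢ w (inj₂ t) = prefixed-≢-cons n {zero} letter+2 (containing01Word n) (λ _ ()) w t

  containingWord-occurs : ∀ a n t → Occurs a n (containingWord a n t)
  containingWord-occurs a (suc n) t with splitAt ((2 ℕ.+ q) ℕ.^ n) t
  ... | inj₁ w = Occurs-cons n a w (inj₁ ≡.refl)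
  ... | inj₂ u = Occurs-cons n (Fin.punchIn a (proj₁ (remQuot (#containing n) u))) _
                   (inj₂ (containingWord-occurs a n (proj₂ (remQuot (#containing n) u))))

  containing01Word-occurs : ∀ n t →
                            Occurs zero n (containing01Word n t) × Occurs (suc zero) n (containing01Word n t)
  containing01Word-occurs (suc n) t with splitAt (#containing n) t
  ... | inj₁ u = Occurs-cons n zero _ (inj₁ ≡.refl)
               , Occurs-cons n zero _ (inj₂ (containingWord-occurs (suc zero) n u))
  ... | inj₂ t′ with splitAt (#containing n) t′
  ...   | inj₁ u = Occurs-cons n (suc zero) _ (inj₂ (containingWord-occurs zero n u))
                 , Occurs-cons n (suc zero) _ (inj₁ ≡.refl)
  ...   | inj₂ u = let (b , w) = remQuot (#containing01 n) u
                       (occurs₀ , occurs₁) = containing01Word-occurs n w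
                   in Occurs-cons n (letter+2 b) _ (inj₂ occurs₀)
                    , Occurs-cons n (letter+2 b) _ (inj₂ occurs₁)

  #containing-+ : ∀ n → #containing n ℕ.+ suc q ℕ.^ n ≡ (2 ℕ.+ q) ℕ.^ n
  #containing-+ zero    = ≡.refl
  #containing-+ (suc n) = ≡.trans
    (solve 4 (λ s A D B → (A :+ s :* D) :+ s :* B := A :+ s :* (D :+ B))
           ≡.refl (suc q) ((2 ℕ.+ q) ℕ.^ n) (#containing n) (suc q ℕ.^ n))
    (≡.cong (λ x → (2 ℕ.+ q) ℕ.^ n ℕ.+ suc q ℕ.* x) (#containing-+ n))
    where open Data.Nat.Solver.+-*-Solver using (solve; _:+_; _:*_; _:=_)

  #containing01-+ : ∀ n → #containing01 n ℕ.+ 2 ℕ.* suc q ℕ.^ n ≡ (2 ℕ.+ q) ℕ.^ n ℕ.+ q ℕ.^ n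
  #containing01-+ zero    = ≡.refl
  #containing01-+ (suc n) = ≡.trans
    (solve 4 (λ Q D S B → (D :+ (D :+ Q :* S)) :+ con 2 :* ((con 1 :+ Q) :* B)
                          := con 2 :* (D :+ B) :+ Q :* (S :+ con 2 :* B))
           ≡.refl q (#containing n) (#containing01 n) (suc q ℕ.^ n))
    (≡.trans (≡.cong₂ (λ x y → 2 ℕ.* x ℕ.+ q ℕ.* y) (#containing-+ n) (#containing01-+ n))
      (solve 3 (λ Q A C → con 2 :* A :+ Q :* (A :+ C) := (con 2 :+ Q) :* A :+ Q :* C)
             ≡.refl q ((2 ℕ.+ q) ℕ.^ n) (q ℕ.^ n)))
    where open Data.Nat.Solver.+-*-Solver using (solve; _:+_; _:*_; _:=_; con)

  #containing01-≡ : ∀ n → ((q ℕ.+ 2) ℕ.^ n ℕ.+ q ℕ.^ n) ∸ 2 ℕ.* (q ℕ.+ 1) ℕ.^ n ≡ #containing01 n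
  #containing01-≡ n rewrite ℕP.+-comm q 2 | ℕP.+-comm q 1 | ≡.sym (#containing01-+ n) =
    ℕP.m+n∸n≡m (#containing01 n) (2 ℕ.* suc q ℕ.^ n)

module SeriesDegenerations {c ℓ : Level} (K : CommutativeRing c ℓ) where
  private module K = CommutativeRing K
  open Tensors K using (Tensor; PolyMat; coeff; Σ≤; _⊴_; _⊕_; unit; mm1s1)
  open FormalPowerSeries K
  open LeadingTerms K
  open CommutativeRing seriesRing hiding (zero)
  open Tensors seriesRing using (ΣFin; δ)
  open FiniteSums seriesRing
  open IntegerCoefficientSolver seriesRing using (solve; _:*_; _:=_)

  SeriesMatrix : ℕ → ℕ → Set c
  SeriesMatrix m n = Fin m → Fin n → Series

  coefficients : ∀ {m n} → SeriesMatrix m n → PolyMat m n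
  coefficients M p i j = M i j p

  DegreeBounded : ∀ {m n} → SeriesMatrix m n → Set ℓ
  DegreeBounded M = Σ ℕ λ D → ∀ i j → Deg≤ D (M i j)

  transform : ∀ {a b d a′ b′ d′} → SeriesMatrix a a′ → SeriesMatrix b b′ → SeriesMatrix d d′ →
              Tensor a′ b′ d′ → Fin a → Fin b → Fin d → Series
  transform {a′ = a′} {b′} {d′} A B C S i j k =
    ΣFin a′ λ i′ → ΣFin b′ λ j′ → ΣFin d′ λ k′ → A i i′ * (B j j′ * (const (S i′ j′ k′) * C k k′))

  coeff-transform : ∀ {a b d a′ b′ d′} (A : SeriesMatrix a a′) (B : SeriesMatrix b b′) (C : SeriesMatrix d d′)
                    (S : Tensor a′ b′ d′) m i j k →
                    coeff (coefficients A) (coefficients B) (coefficients C) S m i j k K.≈ transform A B C S i j k m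
  coeff-transform {a′ = a′} {b′} {d′} A B C S m i j k = begin
    Σ≤² (λ p p′ → ΣK a′ λ i′ → ΣK b′ λ j′ → ΣK d′ λ k′ → term i′ j′ k′ p p′)
      ≈⟨ Σ≤²-ΣK a′ _ ⟩
    ΣK a′ (λ i′ → Σ≤² λ p p′ → ΣK b′ λ j′ → ΣK d′ λ k′ → term i′ j′ k′ p p′)
      ≈⟨ FK.ΣFin-cong a′ (λ i′ → Σ≤²-ΣK b′ _) ⟩
    ΣK a′ (λ i′ → ΣK b′ λ j′ → Σ≤² λ p p′ → ΣK d′ λ k′ → term i′ j′ k′ p p′)
      ≈⟨ FK.ΣFin-cong a′ (λ i′ → FK.ΣFin-cong b′ (λ j′ → Σ≤²-ΣK d′ _)) ⟩
    ΣK a′ (λ i′ → ΣK b′ λ j′ → ΣK d′ λ k′ → Σ≤² (term i′ j′ k′))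
      ≈⟨ FK.ΣFin-cong a′ (λ i′ → FK.ΣFin-cong b′ (λ j′ → FK.ΣFin-cong d′ (λ k′ →
           triple-product-coeff (A i i′) (B j j′) (C k k′) (S i′ j′ k′) m))) ⟩
    ΣK a′ (λ i′ → ΣK b′ λ j′ → ΣK d′ λ k′ → (A i i′ * (B j j′ * (const (S i′ j′ k′) * C k k′))) m)
      ≈⟨ FK.ΣFin-cong a′ (λ i′ → FK.ΣFin-cong b′ (λ j′ → ΣFin-coeff d′ _ m)) ⟨
    ΣK a′ (λ i′ → ΣK b′ λ j′ → ΣFin d′ (λ k′ → A i i′ * (B j j′ * (const (S i′ j′ k′) * C k k′))) m)
      ≈⟨ FK.ΣFin-cong a′ (λ i′ → ΣFin-coeff b′ _ m) ⟨
    ΣK a′ (λ i′ → ΣFin b′ (λ j′ → ΣFin d′ λ k′ → A i i′ * (B j j′ * (const (S i′ j′ k′) * C k k′))) m)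
      ≈⟨ ΣFin-coeff a′ _ m ⟨
    transform A B C S i j k m ∎
    where
    open ≈-Reasoning K.setoid
    module FK = FiniteSums K
    module TK = TruncatedSums K
    ΣK = Tensors.ΣFin K

    Σ≤² : (ℕ → ℕ → K.Carrier) → K.Carrier
    Σ≤² F = Σ≤ m λ p → Σ≤ (m ∸ p) (F p)

    Σ≤²-ΣK : ∀ n (F : ℕ → ℕ → Fin n → K.Carrier) →
             Σ≤² (λ p p′ → ΣK n (F p p′)) K.≈ ΣK n (λ i → Σ≤² λ p p′ → F p p′ i)
    Σ≤²-ΣK n F = K.trans (TK.Σ≤-cong m (λ p → TK.Σ≤-ΣFin-comm (m ∸ p) n (F p))) (TK.Σ≤-ΣFin-comm m n _)

    term : Fin a′ → Fin b′ → Fin d′ → ℕ → ℕ → K.Carrier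
    term i′ j′ k′ p p′ = A i i′ p K.* B j j′ p′ K.* C k k′ ((m ∸ p) ∸ p′) K.* S i′ j′ k′

  module _ {a b d a″ b″ d″ : ℕ} where
    block : Tensor a b d → Tensor a″ b″ d″ → Fin a ⊎ Fin a″ → Fin b ⊎ Fin b″ → Fin d ⊎ Fin d″ → K.Carrier
    block T S (inj₁ i) (inj₁ j) (inj₁ k) = T i j k
    block T S (inj₂ i) (inj₂ j) (inj₂ k) = S i j k
    block T S (inj₁ _) (inj₂ _) _        = K.0#
    block T S (inj₂ _) (inj₁ _) _        = K.0#
    block T S (inj₁ _) (inj₁ _) (inj₂ _) = K.0#
    block T S (inj₂ _) (inj₂ _) (inj₁ _) = K.0#

    ⊕-block : ∀ (T : Tensor a b d) (S : Tensor a″ b″ d″) i j k →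
              (T ⊕ S) i j k ≡ block T S (splitAt a i) (splitAt b j) (splitAt d k)
    ⊕-block T S i j k with splitAt a i | splitAt b j | splitAt d k
    ... | inj₁ _ | inj₁ _ | inj₁ _ = ≡.refl
    ... | inj₂ _ | inj₂ _ | inj₂ _ = ≡.refl
    ... | inj₁ _ | inj₁ _ | inj₂ _ = ≡.refl
    ... | inj₁ _ | inj₂ _ | inj₁ _ = ≡.refl
    ... | inj₁ _ | inj₂ _ | inj₂ _ = ≡.refl
    ... | inj₂ _ | inj₁ _ | inj₁ _ = ≡.refl
    ... | inj₂ _ | inj₁ _ | inj₂ _ = ≡.refl
    ... | inj₂ _ | inj₂ _ | inj₁ _ = ≡.refl

    ⊕-join : ∀ (T : Tensor a b d) (S : Tensor a″ b″ d″) x y z →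
             (T ⊕ S) (join a a″ x) (join b b″ y) (join d d″ z) ≡ block T S x y z
    ⊕-join T S x y z
      rewrite ⊕-block T S (join a a″ x) (join b b″ y) (join d d″ z)
            | FinP.splitAt-join a a″ x | FinP.splitAt-join b b″ y | FinP.splitAt-join d d″ z = ≡.refl

    ⊕-↑ˡ↑ʳ : ∀ (T : Tensor a b d) (S : Tensor a″ b″ d″) i j k → (T ⊕ S) (i ↑ˡ a″) (b ↑ʳ j) k ≡ K.0#
    ⊕-↑ˡ↑ʳ T S i j k rewrite ⊕-block T S (i ↑ˡ a″) (b ↑ʳ j) k
                           | FinP.splitAt-↑ˡ a i a″ | FinP.splitAt-↑ʳ b b″ j = ≡.refl

    ⊕-↑ʳ↑ˡ : ∀ (T : Tensor a b d) (S : Tensor a″ b″ d″) i j k → (T ⊕ S) (a ↑ʳ i) (j ↑ˡ b″) k ≡ K.0#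
    ⊕-↑ʳ↑ˡ T S i j k rewrite ⊕-block T S (a ↑ʳ i) (j ↑ˡ b″) k
                           | FinP.splitAt-↑ʳ a a″ i | FinP.splitAt-↑ˡ b j b″ = ≡.refl

  zero-entry-vanishes : ∀ x y z → x * (y * (const K.0# * z)) ≈ 0#
  zero-entry-vanishes x y z = begin
    x * (y * (const K.0# * z)) ≈⟨ *-congˡ (*-congˡ (*-congʳ const-0#)) ⟩
    x * (y * (0# * z))         ≈⟨ *-congˡ (trans (*-congˡ (zeroˡ z)) (zeroʳ y)) ⟩
    x * 0#                     ≈⟨ zeroʳ x ⟩
    0#                         ∎
    where open ≈-Reasoning setoid

  transform-⊕ : ∀ {a b d a′ b′ d′ a″ b″ d″} (A : SeriesMatrix a (a′ ℕ.+ a″)) (B : SeriesMatrix b (b′ ℕ.+ b″))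
                (C : SeriesMatrix d (d′ ℕ.+ d″)) (T : Tensor a′ b′ d′) (S : Tensor a″ b″ d″) i j k →
                transform A B C (T ⊕ S) i j k
                  ≈ transform (λ i i′ → A i (i′ ↑ˡ a″)) (λ j j′ → B j (j′ ↑ˡ b″)) (λ k k′ → C k (k′ ↑ˡ d″)) T i j k
                  + transform (λ i i′ → A i (a′ ↑ʳ i′)) (λ j j′ → B j (b′ ↑ʳ j′)) (λ k k′ → C k (d′ ↑ʳ k′)) S i j k
  transform-⊕ {a′ = a′} {b′} {d′} {a″} {b″} {d″} A B C T S i j k =
    trans (ΣFin-splitAt a′ a″ _) (+-cong
      (ΣFin-cong a′ λ x → trans
        (ΣFin-↑ˡ b′ b″ (λ y → ΣFin (d′ ℕ.+ d″) (entry (x ↑ˡ a″) y)) λ y →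
          ΣFin-zero (d′ ℕ.+ d″) λ z → vanishes (⊕-↑ˡ↑ʳ T S x y z))
        (ΣFin-cong b′ λ y → trans
          (ΣFin-↑ˡ d′ d″ (entry (x ↑ˡ a″) (y ↑ˡ b″)) λ z → vanishes (⊕-join T S (inj₁ x) (inj₁ y) (inj₂ z)))
          (ΣFin-cong d′ λ z → entry-≡ (⊕-join T S (inj₁ x) (inj₁ y) (inj₁ z)))))
      (ΣFin-cong a″ λ x → trans
        (ΣFin-↑ʳ b′ b″ (λ y → ΣFin (d′ ℕ.+ d″) (entry (a′ ↑ʳ x) y)) λ y →
          ΣFin-zero (d′ ℕ.+ d″) λ z → vanishes (⊕-↑ʳ↑ˡ T S x y z))
        (ΣFin-cong b″ λ y → trans
          (ΣFin-↑ʳ d′ d″ (entry (a′ ↑ʳ x) (b′ ↑ʳ y)) λ z → vanishes (⊕-join T S (inj₂ x) (inj₂ y) (inj₁ z)))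
          (ΣFin-cong d″ λ z → entry-≡ (⊕-join T S (inj₂ x) (inj₂ y) (inj₂ z))))))
    where
    entry : Fin (a′ ℕ.+ a″) → Fin (b′ ℕ.+ b″) → Fin (d′ ℕ.+ d″) → Series
    entry i′ j′ k′ = A i i′ * (B j j′ * (const ((T ⊕ S) i′ j′ k′) * C k k′))

    entry-≡ : ∀ {i′ j′ k′ t} → (T ⊕ S) i′ j′ k′ ≡ t → entry i′ j′ k′ ≈ A i i′ * (B j j′ * (const t * C k k′))
    entry-≡ {i′} {j′} {k′} eq = reflexive (≡.cong (λ t → A i i′ * (B j j′ * (const t * C k k′))) eq)

    vanishes : ∀ {i′ j′ k′} → (T ⊕ S) i′ j′ k′ ≡ K.0# → entry i′ j′ k′ ≈ 0#
    vanishes eq = trans (entry-≡ eq) (zero-entry-vanishes _ _ _)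

  const-δ : ∀ {n} (x y : Fin n) → const (Tensors.δ K x y) ≈ δ x y
  const-δ x y with x Fin.≟ y
  ... | yes _ = refl
  ... | no  _ = const-0#

  unit-δ : ∀ {r} (x y z : Fin r) → unit r x y z K.≈ Tensors.δ K x y K.* Tensors.δ K y z
  unit-δ x y z with x Fin.≟ y | y Fin.≟ z
  ... | yes _ | yes _ = K.sym (K.*-identityˡ _)
  ... | yes _ | no  _ = K.sym (K.zeroʳ _)
  ... | no  _ | yes _ = K.sym (K.zeroˡ _)
  ... | no  _ | no  _ = K.sym (K.zeroˡ _)

  transform-unit : ∀ {a b d r} (A : SeriesMatrix a r) (B : SeriesMatrix b r) (C : SeriesMatrix d r) i j k →
                   transform A B C (unit r) i j k ≈ ΣFin r (λ w → A i w * (B j w * C k w))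
  transform-unit {r = r} A B C i j k = ΣFin-cong r λ x → begin
    ΣFin r (λ y → ΣFin r λ z → A i x * (B j y * (const (unit r x y z) * C k z)))
      ≈⟨ ΣFin-cong r (λ y → ΣFin-cong r (λ z → rearrange x y z)) ⟩
    ΣFin r (λ y → ΣFin r λ z → δ x y * (δ y z * (A i x * (B j y * C k z))))
      ≈⟨ ΣFin-cong r (λ y → trans (sym (*-distribˡ-ΣFin r (δ x y) _)) (*-congˡ (ΣFin-δ r y λ z → A i x * (B j y * C k z)))) ⟩
    ΣFin r (λ y → δ x y * (A i x * (B j y * C k y)))
      ≈⟨ ΣFin-δ r x (λ y → A i x * (B j y * C k y)) ⟩
    A i x * (B j x * C k x) ∎
    where
    open ≈-Reasoning setoid
    rearrange : ∀ x y z → A i x * (B j y * (const (unit r x y z) * C k z))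
                          ≈ δ x y * (δ y z * (A i x * (B j y * C k z)))
    rearrange x y z = trans
      (*-congˡ (*-congˡ (*-congʳ (trans (const-cong (unit-δ x y z))
                                 (trans (const-* _ _) (*-cong (const-δ x y) (const-δ y z)))))))
      (solve 5 (λ X Y D E Z → X :* (Y :* ((D :* E) :* Z)) := D :* (E :* (X :* (Y :* Z))))
             refl (A i x) (B j y) (δ x y) (δ y z) (C k z))

  transform-mm1s1 : ∀ {a b d s} (A : SeriesMatrix a s) (B : SeriesMatrix b s) (C : SeriesMatrix d 1) i j k →
                    transform A B C (mm1s1 s) i j k ≈ ΣFin s (λ l → A i l * (B j l * C k zero))
  transform-mm1s1 {s = s} A B C i j k = ΣFin-cong s λ x → trans
    (ΣFin-cong s λ y → trans (+-identityʳ _) (rearrange x y))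
    (ΣFin-δ s x (λ y → A i x * (B j y * C k zero)))
    where
    rearrange : ∀ x y → A i x * (B j y * (const (Tensors.δ K x y) * C k zero))
                        ≈ δ x y * (A i x * (B j y * C k zero))
    rearrange x y = trans (*-congˡ (*-congˡ (*-congʳ (const-δ x y))))
      (solve 4 (λ X Y D Z → X :* (Y :* (D :* Z)) := D :* (X :* (Y :* Z))) refl (A i x) (B j y) (δ x y) (C k zero))

  ⊴-from-series : ∀ {a b d a′ b′ d′} {T : Tensor a b d} {S : Tensor a′ b′ d′}
                  (A : SeriesMatrix a a′) (B : SeriesMatrix b b′) (C : SeriesMatrix d d′) →
                  DegreeBounded A → DegreeBounded B → DegreeBounded C →
                  ∀ e → (∀ i j k → transform A B C S i j k ≃ T i j k ·ε^ e) → T ⊴ S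
  ⊴-from-series {S = S} A B C (DA , A≤DA) (DB , B≤DB) (DC , C≤DC) e expansion = record
    { A      = coefficients A
    ; B      = coefficients B
    ; C      = coefficients C
    ; A-poly = DA , λ p DA<p i j → A≤DA i j p DA<p
    ; B-poly = DB , λ p DB<p i j → B≤DB i j p DB<p
    ; C-poly = DC , λ p DC<p i j → C≤DC i j p DC<p
    ; e      = e
    ; below  = λ m m<e i j k → K.trans (coeff-transform A B C S m i j k) (≃-coeff-< (expansion i j k) m<e)
    ; lead   = λ i j k → K.trans (coeff-transform A B C S e i j k) (≃-coeff-≡ (expansion i j k))
    }

  module _ {m m′ k k′ : ℕ} where
    blockMatrix : (Fin m ⊎ Fin m′ → Fin k ⊎ Fin k′ → Series) → SeriesMatrix (m ℕ.+ m′) (k ℕ.+ k′)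
    blockMatrix M i j = M (splitAt m i) (splitAt k j)

    blockMatrix-↑ˡ : ∀ M x j → blockMatrix M (join m m′ x) (j ↑ˡ k′) ≡ M x (inj₁ j)
    blockMatrix-↑ˡ M x j = ≡.cong₂ M (FinP.splitAt-join m m′ x) (FinP.splitAt-↑ˡ k j k′)

    blockMatrix-↑ʳ : ∀ M x j → blockMatrix M (join m m′ x) (k ↑ʳ j) ≡ M x (inj₂ j)
    blockMatrix-↑ʳ M x j = ≡.cong₂ M (FinP.splitAt-join m m′ x) (FinP.splitAt-↑ʳ k k′ j)

    blockMatrix-degree : ∀ {M} D → (∀ x y → Deg≤ D (M x y)) → DegreeBounded (blockMatrix M)
    blockMatrix-degree D M≤D = D , λ i j → M≤D (splitAt m i) (splitAt k j)

  transform-unit⊕mm1s1 :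
    ∀ {a b d r s} (A : Fin a ⊎ Fin b → Fin r ⊎ Fin s → Series) (B : Fin a ⊎ Fin b → Fin r ⊎ Fin s → Series)
    (C : Fin d ⊎ Fin 1 → Fin r ⊎ Fin 1 → Series) x y z →
    transform (blockMatrix A) (blockMatrix B) (blockMatrix C) (unit r ⊕ mm1s1 s) (join a b x) (join a b y) (join d 1 z)
      ≈ ΣFin r (λ w → A x (inj₁ w) * (B y (inj₁ w) * C z (inj₁ w)))
      + ΣFin s (λ l → A x (inj₂ l) * (B y (inj₂ l) * C z (inj₂ zero)))
  transform-unit⊕mm1s1 {a} {b} {d} {r} {s} A B C x y z = trans
    (transform-⊕ (blockMatrix A) (blockMatrix B) (blockMatrix C) (unit r) (mm1s1 s) i j k) (+-cong
    (trans (transform-unit (λ i i′ → blockMatrix A i (i′ ↑ˡ s)) (λ j j′ → blockMatrix B j (j′ ↑ˡ s))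
                           (λ k k′ → blockMatrix C k (k′ ↑ˡ 1)) i j k)
           (ΣFin-cong r λ w → reflexive (≡.cong₂ _*_ (blockMatrix-↑ˡ A x w)
             (≡.cong₂ _*_ (blockMatrix-↑ˡ B y w) (blockMatrix-↑ˡ C z w)))))
    (trans (transform-mm1s1 (λ i i′ → blockMatrix A i (r ↑ʳ i′)) (λ j j′ → blockMatrix B j (r ↑ʳ j′))
                            (λ k k′ → blockMatrix C k (r ↑ʳ k′)) i j k)
           (ΣFin-cong s λ l → reflexive (≡.cong₂ _*_ (blockMatrix-↑ʳ A x l)
             (≡.cong₂ _*_ (blockMatrix-↑ʳ B y l) (blockMatrix-↑ʳ C z zero))))))
    where
    i = join a b x
    j = join a b y
    k = join d 1 z

module KroneckerPowers {c ℓ : Level} (R : CommutativeRing c ℓ) where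
  open CommutativeRing R hiding (zero)

  hd : ∀ {m} n → Fin (m ℕ.^ suc n) → Fin m
  hd {m} n = proj₁ ∘ remQuot {m} (m ℕ.^ n)

  tl : ∀ {m} n → Fin (m ℕ.^ suc n) → Fin (m ℕ.^ n)
  tl {m} n = proj₂ ∘ remQuot {m} (m ℕ.^ n)

  hd-combine : ∀ {m} n (i : Fin m) (j : Fin (m ℕ.^ n)) → hd n (combine i j) ≡ i
  hd-combine n i j = ≡.cong proj₁ (FinP.remQuot-combine i j)

  tl-combine : ∀ {m} n (i : Fin m) (j : Fin (m ℕ.^ n)) → tl n (combine i j) ≡ j
  tl-combine n i j = ≡.cong proj₂ (FinP.remQuot-combine i j)

  kron : ∀ {m} n → (Fin m → Carrier) → Fin (m ℕ.^ n) → Carrier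
  kron zero    f _ = 1#
  kron (suc n) f w = f (hd n w) * kron n f (tl n w)

  kron₂ : ∀ {m k} n → (Fin m → Fin k → Carrier) → Fin (m ℕ.^ n) → Fin (k ℕ.^ n) → Carrier
  kron₂ zero    f _ _ = 1#
  kron₂ (suc n) f w x = f (hd n w) (hd n x) * kron₂ n f (tl n w) (tl n x)

  kron-combine : ∀ {m} n (f : Fin m → Carrier) l w → kron (suc n) f (combine l w) ≈ f l * kron n f w
  kron-combine {m} n f l w =
    reflexive (≡.cong₂ (λ l′ w′ → f l′ * kron n f w′) (hd-combine {m} n l w) (tl-combine {m} n l w))

  kron₂-combineˡ : ∀ {m k} n (f : Fin m → Fin k → Carrier) l w x →
                   kron₂ (suc n) f (combine l w) x ≈ f l (hd n x) * kron₂ n f w (tl n x)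
  kron₂-combineˡ {m} n f l w x =
    reflexive (≡.cong₂ (λ l′ w′ → f l′ (hd n x) * kron₂ n f w′ (tl n x))
                       (hd-combine {m} n l w) (tl-combine {m} n l w))

  kron₂-combineʳ : ∀ {m k} n (f : Fin m → Fin k → Carrier) σ l w →
                   kron₂ (suc n) f σ (combine l w) ≈ f (hd n σ) l * kron₂ n f (tl n σ) w
  kron₂-combineʳ {k = k} n f σ l w =
    reflexive (≡.cong₂ (λ l′ w′ → f (hd n σ) l′ * kron₂ n f (tl n σ) w′)
                       (hd-combine {k} n l w) (tl-combine {k} n l w))

module CoppersmithWinogradLetters {c ℓ : Level} (K : CommutativeRing c ℓ) (q : ℕ) where
  private module K = CommutativeRing K
  open Tensors K using (cw)
  open FormalPowerSeries K
    using (Series; seriesRing; const; ε; ε^_; const-0#; const-cong;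
           Deg≤; Deg≤-const; Deg≤-0ₛ; Deg≤-ε; Deg≤-+; Deg≤--ₛ; Deg≤-*ₛ; Deg≤-ΣFin)
  open LeadingTerms K
  open SeriesDegenerations K using (const-δ)
  open CommutativeRing seriesRing hiding (zero)
  open Tensors seriesRing using (ΣFin; δ)
  open FiniteSums seriesRing
  open IntegerCoefficientSolver seriesRing using (solve; _:+_; _:*_; _:-_; :-_; _:=_; :0; :1)
  open Words q using (Letter; letter+2)

  qε : Series
  qε = ΣFin q (λ _ → ε)

  weight : Letter → Series
  weight zero          = 1# + - qε
  weight (suc zero)    = - 1#
  weight (suc (suc _)) = ε

  vector : Letter → Fin (suc q) → Series
  vector _             zero    = 1#
  vector zero          (suc i) = 0#
  vector (suc zero)    (suc i) = ε * ε
  vector (suc (suc j)) (suc i) = ε * δ i j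

  one : Letter → Series
  one _ = 1#

  form₁ : (Letter → Series) → (Letter → Series) → (Letter → Series) → Series
  form₁ u v x = ΣFin (2 ℕ.+ q) (λ l → weight l * (u l * (v l * x l)))

  -- A sum over the letters unfolds to the terms of the letters 0 and 1 plus a tail over
  -- the letters i + 2, evaluated by tail-const or tail-δ; the ring solver does the rest.
  tail-const : ∀ c {f : Fin q → Series} → (∀ j → f j ≈ ε * c) → ΣFin q f ≈ qε * c
  tail-const c f≈ = trans (ΣFin-cong q f≈) (sym (*-distribʳ-ΣFin q c (λ _ → ε)))

  tail-δ : ∀ i (g : Fin q → Series) {f : Fin q → Series} → (∀ j → f j ≈ δ i j * g j) → ΣFin q f ≈ g i
  tail-δ i g f≈ = trans (ΣFin-cong q f≈) (ΣFin-δ q i g)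

  weights-annihilate : ∀ I → ΣFin (2 ℕ.+ q) (λ l → weight l * vector l I) ≈ 0#
  weights-annihilate zero = trans (+-congˡ (+-congˡ (tail-const 1# (λ _ → refl))))
    (solve 1 (λ Q → (:1 :- Q) :* :1 :+ (:- :1 :* :1 :+ Q :* :1) := :0) refl qε)
  weights-annihilate (suc i) =
    trans (+-congˡ (+-congˡ (tail-δ i (λ _ → ε * ε) λ j →
            solve 2 (λ E D → E :* (E :* D) := D :* (E :* E)) refl ε (δ i j))))
          (solve 2 (λ Q E → (:1 :- Q) :* :0 :+ (:- :1 :* (E :* E) :+ E :* E) := :0) refl qε ε)

  cw-border₁ : ∀ I J L → form₁ (λ l → vector l I) (λ l → vector l J) (λ l → vector l L) ≃ cw q I J L ·ε^ 3
  cw-border₁ zero zero zero = ≃-intro 0#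
    (trans (+-congˡ (+-congˡ (tail-const (1# * (1# * 1#)) (λ _ → refl))))
      (solve 2 (λ Q E → (:1 :- Q) :* (:1 :* (:1 :* :1)) :+ (:- :1 :* (:1 :* (:1 :* :1)) :+ Q :* (:1 :* (:1 :* :1)))
                        := E :* (E :* (E :* :1)) :* (:0 :+ E :* :0)) refl qε ε))
    (sym const-0#)
  cw-border₁ zero zero (suc k) = ≃-intro 0#
    (trans (+-congˡ (+-congˡ (tail-δ k (λ _ → ε * ε) λ j →
              solve 2 (λ E D → E :* (:1 :* (:1 :* (E :* D))) := D :* (E :* E)) refl ε (δ k j))))
      (solve 2 (λ Q E → (:1 :- Q) :* (:1 :* (:1 :* :0)) :+ (:- :1 :* (:1 :* (:1 :* (E :* E))) :+ E :* E)
                        := E :* (E :* (E :* :1)) :* (:0 :+ E :* :0)) refl qε ε))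
    (sym const-0#)
  cw-border₁ zero (suc j) zero = ≃-intro 0#
    (trans (+-congˡ (+-congˡ (tail-δ j (λ _ → ε * ε) λ l →
              solve 2 (λ E D → E :* (:1 :* ((E :* D) :* :1)) := D :* (E :* E)) refl ε (δ j l))))
      (solve 2 (λ Q E → (:1 :- Q) :* (:1 :* (:0 :* :1)) :+ (:- :1 :* (:1 :* ((E :* E) :* :1)) :+ E :* E)
                        := E :* (E :* (E :* :1)) :* (:0 :+ E :* :0)) refl qε ε))
    (sym const-0#)
  cw-border₁ (suc i) zero zero = ≃-intro 0#
    (trans (+-congˡ (+-congˡ (tail-δ i (λ _ → ε * ε) λ l →
              solve 2 (λ E D → E :* ((E :* D) :* (:1 :* :1)) := D :* (E :* E)) refl ε (δ i l))))
      (solve 2 (λ Q E → (:1 :- Q) :* (:0 :* (:1 :* :1)) :+ (:- :1 :* ((E :* E) :* (:1 :* :1)) :+ E :* E)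
                        := E :* (E :* (E :* :1)) :* (:0 :+ E :* :0)) refl qε ε))
    (sym const-0#)
  cw-border₁ zero (suc j) (suc k) = ≃-intro (- 1#)
    (trans (+-congˡ (+-congˡ (tail-δ j (λ l → ε * (ε * (ε * δ k l))) λ l →
              solve 3 (λ E D D′ → E :* (:1 :* ((E :* D) :* (E :* D′))) := D :* (E :* (E :* (E :* D′))))
                      refl ε (δ j l) (δ k l))))
      (solve 3 (λ Q E D → (:1 :- Q) :* (:1 :* (:0 :* :0)) :+ (:- :1 :* (:1 :* ((E :* E) :* (E :* E)))
                          :+ E :* (E :* (E :* D))) := E :* (E :* (E :* :1)) :* (D :+ E :* :- :1))
             refl qε ε (δ k j)))
    (trans (δ-sym k j) (sym (const-δ j k)))
  cw-border₁ (suc i) zero (suc k) = ≃-intro (- 1#)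
    (trans (+-congˡ (+-congˡ (tail-δ i (λ l → ε * (ε * (ε * δ k l))) λ l →
              solve 3 (λ E D D′ → E :* ((E :* D) :* (:1 :* (E :* D′))) := D :* (E :* (E :* (E :* D′))))
                      refl ε (δ i l) (δ k l))))
      (solve 3 (λ Q E D → (:1 :- Q) :* (:0 :* (:1 :* :0)) :+ (:- :1 :* ((E :* E) :* (:1 :* (E :* E)))
                          :+ E :* (E :* (E :* D))) := E :* (E :* (E :* :1)) :* (D :+ E :* :- :1))
             refl qε ε (δ k i)))
    (trans (δ-sym k i) (sym (const-δ i k)))
  cw-border₁ (suc i) (suc j) zero = ≃-intro (- 1#)
    (trans (+-congˡ (+-congˡ (tail-δ i (λ l → ε * (ε * (ε * δ j l))) λ l →
              solve 3 (λ E D D′ → E :* ((E :* D) :* ((E :* D′) :* :1)) := D :* (E :* (E :* (E :* D′))))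
                      refl ε (δ i l) (δ j l))))
      (solve 3 (λ Q E D → (:1 :- Q) :* (:0 :* (:0 :* :1)) :+ (:- :1 :* ((E :* E) :* ((E :* E) :* :1))
                          :+ E :* (E :* (E :* D))) := E :* (E :* (E :* :1)) :* (D :+ E :* :- :1))
             refl qε ε (δ j i)))
    (trans (δ-sym j i) (sym (const-δ i j)))
  cw-border₁ (suc i) (suc j) (suc k) = ≃-intro (δ j i * δ k i + - (ε * ε))
    (trans (+-congˡ (+-congˡ (tail-δ i (λ l → ε * (ε * (ε * (ε * (δ j l * δ k l))))) λ l →
              solve 4 (λ E D D′ D″ → E :* ((E :* D) :* ((E :* D′) :* (E :* D″)))
                                     := D :* (E :* (E :* (E :* (E :* (D′ :* D″))))))
                      refl ε (δ i l) (δ j l) (δ k l))))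
      (solve 4 (λ Q E D D′ → (:1 :- Q) :* (:0 :* (:0 :* :0)) :+ (:- :1 :* ((E :* E) :* ((E :* E) :* (E :* E)))
                             :+ E :* (E :* (E :* (E :* (D :* D′)))))
                             := E :* (E :* (E :* :1)) :* (:0 :+ E :* (D :* D′ :+ :- (E :* E))))
             refl qε ε (δ j i) (δ k i)))
    (sym const-0#)

  factorˡ factorʳ : Fin q → Fin (suc q) → Series
  factorˡ m zero    = 0#
  factorˡ m (suc i) = δ i m
  factorʳ m zero    = 0#
  factorʳ m (suc j) = δ j m + - ε

  pairing₁ : ∀ I J → form₁ (λ l → vector l I) (λ l → vector l J) one
                     ≈ ε^ 3 * ΣFin q (λ m → factorˡ m I * factorʳ m J)
  pairing₁ zero zero = trans
    (trans (+-congˡ (+-congˡ (tail-const (1# * (1# * 1#)) (λ _ → refl))))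
      (solve 1 (λ Q → (:1 :- Q) :* (:1 :* (:1 :* :1)) :+ (:- :1 :* (:1 :* (:1 :* :1)) :+ Q :* (:1 :* (:1 :* :1)))
                      := :0) refl qε))
    (sym (trans (*-congˡ (ΣFin-zero q (λ _ → zeroˡ 0#))) (zeroʳ _)))
  pairing₁ zero (suc j) = trans
    (trans (+-congˡ (+-congˡ (tail-δ j (λ _ → ε * ε) λ l →
              solve 2 (λ E D → E :* (:1 :* ((E :* D) :* :1)) := D :* (E :* E)) refl ε (δ j l))))
      (solve 2 (λ Q E → (:1 :- Q) :* (:1 :* (:0 :* :1)) :+ (:- :1 :* (:1 :* ((E :* E) :* :1)) :+ E :* E) := :0)
             refl qε ε))
    (sym (trans (*-congˡ (ΣFin-zero q (λ _ → zeroˡ _))) (zeroʳ _)))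
  pairing₁ (suc i) zero = trans
    (trans (+-congˡ (+-congˡ (tail-δ i (λ _ → ε * ε) λ l →
              solve 2 (λ E D → E :* ((E :* D) :* (:1 :* :1)) := D :* (E :* E)) refl ε (δ i l))))
      (solve 2 (λ Q E → (:1 :- Q) :* (:0 :* (:1 :* :1)) :+ (:- :1 :* ((E :* E) :* (:1 :* :1)) :+ E :* E) := :0)
             refl qε ε))
    (sym (trans (*-congˡ (ΣFin-zero q (λ _ → zeroʳ _))) (zeroʳ _)))
  pairing₁ (suc i) (suc j) = trans
    (trans (+-congˡ (+-congˡ (tail-δ i (λ l → ε * (ε * (ε * δ j l))) λ l →
              solve 3 (λ E D D′ → E :* ((E :* D) :* ((E :* D′) :* :1)) := D :* (E :* (E :* (E :* D′))))
                      refl ε (δ i l) (δ j l))))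
      (solve 3 (λ Q E D → (:1 :- Q) :* (:0 :* (:0 :* :1)) :+ (:- :1 :* ((E :* E) :* ((E :* E) :* :1))
                          :+ E :* (E :* (E :* D))) := E :* (E :* (E :* :1)) :* (D :- E))
             refl qε ε (δ j i)))
    (*-congˡ (sym (ΣFin-δ q i (λ m → δ j m + - ε))))

  dualˡ dualʳ : Letter → Letter → Series
  dualˡ zero          _             = - 1#
  dualˡ (suc zero)    (suc zero)    = - ε
  dualˡ (suc (suc x)) (suc zero)    = ε
  dualˡ (suc (suc x)) (suc (suc l)) = δ x l
  dualˡ _             _             = 0#
  dualʳ zero          (suc zero)    = ε
  dualʳ (suc zero)    _             = 1#
  dualʳ (suc (suc y)) (suc zero)    = ε
  dualʳ (suc (suc y)) (suc (suc l)) = δ y l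
  dualʳ _             _             = 0#

  dualˡ-annihilates₁ : ∀ {x} → x ≡ zero → ∀ J → form₁ (dualˡ x) (λ l → vector l J) one ≈ 0#
  dualˡ-annihilates₁ ≡.refl J = begin
    ΣFin (2 ℕ.+ q) (λ l → weight l * (- 1# * (vector l J * 1#)))
      ≈⟨ ΣFin-cong (2 ℕ.+ q) (λ l → solve 2 (λ W A → W :* (:- :1 :* (A :* :1)) := :- :1 :* (W :* A))
                                            refl (weight l) (vector l J)) ⟩
    ΣFin (2 ℕ.+ q) (λ l → - 1# * (weight l * vector l J))
      ≈⟨ *-distribˡ-ΣFin (2 ℕ.+ q) (- 1#) (λ l → weight l * vector l J) ⟨
    - 1# * ΣFin (2 ℕ.+ q) (λ l → weight l * vector l J)
      ≈⟨ trans (*-congˡ (weights-annihilate J)) (zeroʳ _) ⟩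
    0# ∎
    where open ≈-Reasoning setoid

  dualʳ-annihilates₁ : ∀ {y} → y ≡ suc zero → ∀ I → form₁ (λ l → vector l I) (dualʳ y) one ≈ 0#
  dualʳ-annihilates₁ ≡.refl I = trans
    (ΣFin-cong (2 ℕ.+ q) λ l → solve 2 (λ W A → W :* (A :* (:1 :* :1)) := W :* A) refl (weight l) (vector l I))
    (weights-annihilate I)

  δ-letter+2 : ∀ i j → δ i j ≈ const (Tensors.δ K {2 ℕ.+ q} (letter+2 i) (letter+2 j))
  δ-letter+2 i j = trans (sym (const-δ i j))
    (const-cong (K.sym (FiniteSums.δ-injective K letter+2 (FinP.suc-injective ∘ FinP.suc-injective) i j)))

  gram₁ : ∀ x y → form₁ (dualˡ x) (dualʳ y) one ≃ Tensors.δ K x y ·ε^ 1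
  gram₁ zero zero = ≃-intro 0#
    (trans (+-congˡ (+-congˡ (ΣFin-zero q λ _ → solve 1 (λ E → E :* (:- :1 :* (:0 :* :1)) := :0) refl ε)))
      (solve 2 (λ Q E → (:1 :- Q) :* (:- :1 :* (:0 :* :1)) :+ (:- :1 :* (:- :1 :* (E :* :1)) :+ :0)
                        := (E :* :1) :* (:1 :+ E :* :0)) refl qε ε))
    refl
  gram₁ zero (suc zero) = ≃-intro 0#
    (trans (+-congˡ (+-congˡ (tail-const (- 1# * (1# * 1#)) (λ _ → refl))))
      (solve 2 (λ Q E → (:1 :- Q) :* (:- :1 :* (:1 :* :1)) :+ (:- :1 :* (:- :1 :* (:1 :* :1)) :+ Q :* (:- :1 :* (:1 :* :1)))
                        := (E :* :1) :* (:0 :+ E :* :0)) refl qε ε))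
    (sym const-0#)
  gram₁ zero (suc (suc y)) = ≃-intro 0#
    (trans (+-congˡ (+-congˡ (tail-δ y (λ _ → ε * (- 1# * 1#)) λ l →
              solve 2 (λ E D → E :* (:- :1 :* (D :* :1)) := D :* (E :* (:- :1 :* :1))) refl ε (δ y l))))
      (solve 2 (λ Q E → (:1 :- Q) :* (:- :1 :* (:0 :* :1)) :+ (:- :1 :* (:- :1 :* (E :* :1)) :+ E :* (:- :1 :* :1))
                        := (E :* :1) :* (:0 :+ E :* :0)) refl qε ε))
    (sym const-0#)
  gram₁ (suc zero) zero = ≃-intro 1#
    (trans (+-congˡ (+-congˡ (ΣFin-zero q λ _ → solve 1 (λ E → E :* (:0 :* (:0 :* :1)) := :0) refl ε)))
      (solve 2 (λ Q E → (:1 :- Q) :* (:0 :* (:0 :* :1)) :+ (:- :1 :* (:- E :* (E :* :1)) :+ :0)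
                        := (E :* :1) :* (:0 :+ E :* :1)) refl qε ε))
    (sym const-0#)
  gram₁ (suc zero) (suc zero) = ≃-intro 0#
    (trans (+-congˡ (+-congˡ (ΣFin-zero q λ _ → solve 1 (λ E → E :* (:0 :* (:1 :* :1)) := :0) refl ε)))
      (solve 2 (λ Q E → (:1 :- Q) :* (:0 :* (:1 :* :1)) :+ (:- :1 :* (:- E :* (:1 :* :1)) :+ :0)
                        := (E :* :1) :* (:1 :+ E :* :0)) refl qε ε))
    refl
  gram₁ (suc zero) (suc (suc y)) = ≃-intro 1#
    (trans (+-congˡ (+-congˡ (ΣFin-zero q λ l → solve 2 (λ E D → E :* (:0 :* (D :* :1)) := :0) refl ε (δ y l))))
      (solve 2 (λ Q E → (:1 :- Q) :* (:0 :* (:0 :* :1)) :+ (:- :1 :* (:- E :* (E :* :1)) :+ :0)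
                        := (E :* :1) :* (:0 :+ E :* :1)) refl qε ε))
    (sym const-0#)
  gram₁ (suc (suc x)) zero = ≃-intro (- 1#)
    (trans (+-congˡ (+-congˡ (ΣFin-zero q λ l → solve 2 (λ E D → E :* (D :* (:0 :* :1)) := :0) refl ε (δ x l))))
      (solve 2 (λ Q E → (:1 :- Q) :* (:0 :* (:0 :* :1)) :+ (:- :1 :* (E :* (E :* :1)) :+ :0)
                        := (E :* :1) :* (:0 :+ E :* :- :1)) refl qε ε))
    (sym const-0#)
  gram₁ (suc (suc x)) (suc zero) = ≃-intro 0#
    (trans (+-congˡ (+-congˡ (tail-δ x (λ _ → ε * (1# * 1#)) λ l →
              solve 2 (λ E D → E :* (D :* (:1 :* :1)) := D :* (E :* (:1 :* :1))) refl ε (δ x l))))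
      (solve 2 (λ Q E → (:1 :- Q) :* (:0 :* (:1 :* :1)) :+ (:- :1 :* (E :* (:1 :* :1)) :+ E :* (:1 :* :1))
                        := (E :* :1) :* (:0 :+ E :* :0)) refl qε ε))
    (sym const-0#)
  gram₁ (suc (suc x)) (suc (suc y)) = ≃-intro (- 1#)
    (trans (+-congˡ (+-congˡ (tail-δ x (λ l → ε * (δ y l * 1#)) λ l →
              solve 3 (λ E D D′ → E :* (D :* (D′ :* :1)) := D :* (E :* (D′ :* :1))) refl ε (δ x l) (δ y l))))
      (solve 3 (λ Q E D → (:1 :- Q) :* (:0 :* (:0 :* :1)) :+ (:- :1 :* (E :* (E :* :1)) :+ E :* (D :* :1))
                          := (E :* :1) :* (D :+ E :* :- :1)) refl qε ε (δ y x)))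
    (trans (δ-sym y x) (δ-letter+2 x y))

  Deg≤-δ : ∀ D {m} (i j : Fin m) → Deg≤ D (δ i j)
  Deg≤-δ D i j with i Fin.≟ j
  ... | yes _ = Deg≤-const D K.1#
  ... | no  _ = Deg≤-0ₛ D

  Deg≤-weight : ∀ l → Deg≤ 1 (weight l)
  Deg≤-weight zero          = Deg≤-+ (Deg≤-const 1 K.1#) (Deg≤--ₛ (Deg≤-ΣFin q (λ _ → ε) (λ _ → Deg≤-ε)))
  Deg≤-weight (suc zero)    = Deg≤--ₛ (Deg≤-const 1 K.1#)
  Deg≤-weight (suc (suc _)) = Deg≤-ε

  Deg≤-vector : ∀ l I → Deg≤ 2 (vector l I)
  Deg≤-vector _             zero    = Deg≤-const 2 K.1#
  Deg≤-vector zero          (suc i) = Deg≤-0ₛ 2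
  Deg≤-vector (suc zero)    (suc i) = Deg≤-*ₛ Deg≤-ε Deg≤-ε
  Deg≤-vector (suc (suc j)) (suc i) = Deg≤-*ₛ Deg≤-ε (Deg≤-δ 1 i j)

  Deg≤-dualˡ : ∀ x l → Deg≤ 1 (dualˡ x l)
  Deg≤-dualˡ zero          _             = Deg≤--ₛ (Deg≤-const 1 K.1#)
  Deg≤-dualˡ (suc zero)    zero          = Deg≤-0ₛ 1
  Deg≤-dualˡ (suc zero)    (suc zero)    = Deg≤--ₛ Deg≤-ε
  Deg≤-dualˡ (suc zero)    (suc (suc _)) = Deg≤-0ₛ 1
  Deg≤-dualˡ (suc (suc x)) zero          = Deg≤-0ₛ 1
  Deg≤-dualˡ (suc (suc x)) (suc zero)    = Deg≤-ε
  Deg≤-dualˡ (suc (suc x)) (suc (suc l)) = Deg≤-δ 1 x l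

  Deg≤-dualʳ : ∀ y l → Deg≤ 1 (dualʳ y l)
  Deg≤-dualʳ zero          zero          = Deg≤-0ₛ 1
  Deg≤-dualʳ zero          (suc zero)    = Deg≤-ε
  Deg≤-dualʳ zero          (suc (suc _)) = Deg≤-0ₛ 1
  Deg≤-dualʳ (suc zero)    _             = Deg≤-const 1 K.1#
  Deg≤-dualʳ (suc (suc y)) zero          = Deg≤-0ₛ 1
  Deg≤-dualʳ (suc (suc y)) (suc zero)    = Deg≤-ε
  Deg≤-dualʳ (suc (suc y)) (suc (suc l)) = Deg≤-δ 1 y l

  Deg≤-factorˡ : ∀ m I → Deg≤ 0 (factorˡ m I)
  Deg≤-factorˡ m zero    = Deg≤-0ₛ 0
  Deg≤-factorˡ m (suc i) = Deg≤-δ 0 i m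

  Deg≤-factorʳ : ∀ m J → Deg≤ 1 (factorʳ m J)
  Deg≤-factorʳ m zero    = Deg≤-0ₛ 1
  Deg≤-factorʳ m (suc j) = Deg≤-+ (Deg≤-δ 1 j m) (Deg≤--ₛ Deg≤-ε)

module CoppersmithWinogradPowers {c ℓ : Level} (K : CommutativeRing c ℓ) (q : ℕ) where
  private module K = CommutativeRing K
  open Tensors K using (cw; _⊗^_)
  open FormalPowerSeries K using (Series; seriesRing; ε; ε^_; ε^-+; Deg≤; Deg≤-const; Deg≤-*ₛ)
  open LeadingTerms K
  open CommutativeRing seriesRing hiding (zero)
  open Tensors seriesRing using (ΣFin)
  open FiniteSums seriesRing
  open IntegerCoefficientSolver seriesRing using (solve; _:+_; _:*_; _:=_; :0; :1)
  open Words q using (Letter; Word; Occurs)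
  open CoppersmithWinogradLetters K q
  open KroneckerPowers seriesRing

  form : ∀ n → (Word n → Series) → (Word n → Series) → (Word n → Series) → Series
  form n u v x = ΣFin ((2 ℕ.+ q) ℕ.^ n) (λ w → kron n weight w * (u w * (v w * x w)))

  form-suc : ∀ n {u v x : Word (suc n) → Series} (u₁ v₁ x₁ : Letter → Series) (uₙ vₙ xₙ : Word n → Series) →
             (∀ l w → u (combine l w) ≈ u₁ l * uₙ w) → (∀ l w → v (combine l w) ≈ v₁ l * vₙ w) →
             (∀ l w → x (combine l w) ≈ x₁ l * xₙ w) →
             form (suc n) u v x ≈ form₁ u₁ v₁ x₁ * form n uₙ vₙ xₙ
  form-suc n u₁ v₁ x₁ uₙ vₙ xₙ u≈ v≈ x≈ = ΣFin-product (2 ℕ.+ q) ((2 ℕ.+ q) ℕ.^ n) _ _ λ l w → trans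
    (*-cong (kron-combine n weight l w) (*-cong (u≈ l w) (*-cong (v≈ l w) (x≈ l w))))
    (solve 8 (λ S S′ U U′ V V′ X X′ → (S :* S′) :* ((U :* U′) :* ((V :* V′) :* (X :* X′)))
                                      := (S :* (U :* (V :* X))) :* (S′ :* (U′ :* (V′ :* X′))))
           refl (weight l) (kron n weight w) (u₁ l) (uₙ w) (v₁ l) (vₙ w) (x₁ l) (xₙ w))

  ones : ∀ n → Word n → Series
  ones n _ = 1#

  ones-combine : ∀ n (l : Letter) (w : Word n) → ones (suc n) (combine l w) ≈ one l * ones n w
  ones-combine n l w = sym (*-identityˡ 1#)

  vectors : ∀ n → Fin (suc q ℕ.^ n) → Word n → Series
  vectors n I w = kron₂ n vector w I

  vectors-combine : ∀ n I l w → vectors (suc n) I (combine l w) ≈ vector l (hd n I) * vectors n (tl n I) w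
  vectors-combine n I l w = kron₂-combineˡ n vector l w I

  cw-border : ∀ n I J L → form n (vectors n I) (vectors n J) (vectors n L) ≃ (cw q ⊗^ n) I J L ·ε^ (n ℕ.* 3)
  cw-border zero    I J L = ≃-intro 0#
    (solve 1 (λ E → :1 :* (:1 :* (:1 :* :1)) :+ :0 := :1 :* (:1 :+ E :* :0)) refl ε) refl
  cw-border (suc n) I J L = ≈-≃-trans
    (form-suc n _ _ _ _ _ _ (vectors-combine n I) (vectors-combine n J) (vectors-combine n L))
    (≃-* (cw-border₁ (hd n I) (hd n J) (hd n L)) (cw-border n (tl n I) (tl n J) (tl n L)))

  factorsˡ factorsʳ : ∀ n → Fin (q ℕ.^ n) → Fin (suc q ℕ.^ n) → Series
  factorsˡ n = kron₂ n factorˡ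
  factorsʳ n = kron₂ n factorʳ

  pairing : ∀ n I J → form n (vectors n I) (vectors n J) (ones n)
                      ≈ ε^ (n ℕ.* 3) * ΣFin (q ℕ.^ n) (λ m → factorsˡ n m I * factorsʳ n m J)
  pairing zero    I J = solve 0 (:1 :* (:1 :* (:1 :* :1)) :+ :0 := :1 :* (:1 :* :1 :+ :0)) refl
  pairing (suc n) I J = begin
    form (suc n) (vectors (suc n) I) (vectors (suc n) J) (ones (suc n))
      ≈⟨ form-suc n _ _ _ _ _ _ (vectors-combine n I) (vectors-combine n J) (ones-combine n) ⟩
    form₁ (λ l → vector l I₁) (λ l → vector l J₁) one * form n (vectors n I₂) (vectors n J₂) (ones n)
      ≈⟨ *-cong (pairing₁ I₁ J₁) (pairing n I₂ J₂) ⟩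
    (ε^ 3 * P₁) * (ε^ (n ℕ.* 3) * Pₙ)
      ≈⟨ solve 4 (λ A B X Y → (A :* X) :* (B :* Y) := (A :* B) :* (X :* Y)) refl _ _ _ _ ⟩
    (ε^ 3 * ε^ (n ℕ.* 3)) * (P₁ * Pₙ)
      ≈⟨ *-cong (ε^-+ 3 (n ℕ.* 3)) (ΣFin-product q (q ℕ.^ n) _ _ λ m m′ → trans
           (*-cong (kron₂-combineˡ n factorˡ m m′ I) (kron₂-combineˡ n factorʳ m m′ J))
           (solve 4 (λ A B C D → (A :* B) :* (C :* D) := (A :* C) :* (B :* D)) refl _ _ _ _)) ⟨
    ε^ (suc n ℕ.* 3) * ΣFin (q ℕ.^ suc n) (λ m → factorsˡ (suc n) m I * factorsʳ (suc n) m J) ∎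
    where
    open ≈-Reasoning setoid
    I₁ = hd n I
    I₂ = tl n I
    J₁ = hd n J
    J₂ = tl n J
    P₁ = ΣFin q (λ m → factorˡ m I₁ * factorʳ m J₁)
    Pₙ = ΣFin (q ℕ.^ n) (λ m → factorsˡ n m I₂ * factorsʳ n m J₂)

  dualˡ-annihilates : ∀ n σ → Occurs zero n σ → ∀ J → form n (kron₂ n dualˡ σ) (vectors n J) (ones n) ≈ 0#
  dualˡ-annihilates (suc n) σ occurs J = trans
    (form-suc n _ _ _ _ _ _ (kron₂-combineʳ n dualˡ σ) (vectors-combine n J) (ones-combine n))
    (product≈0 occurs)
    where
    product≈0 : Occurs zero (suc n) σ → form₁ (dualˡ (hd n σ)) (λ l → vector l (hd n J)) one
                                        * form n (kron₂ n dualˡ (tl n σ)) (vectors n (tl n J)) (ones n) ≈ 0#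
    product≈0 (inj₁ σ₁≡0)     = trans (*-congʳ (dualˡ-annihilates₁ σ₁≡0 (hd n J))) (zeroˡ _)
    product≈0 (inj₂ occurs′) = trans (*-congˡ (dualˡ-annihilates n (tl n σ) occurs′ (tl n J))) (zeroʳ _)

  dualʳ-annihilates : ∀ n σ → Occurs (suc zero) n σ → ∀ I → form n (vectors n I) (kron₂ n dualʳ σ) (ones n) ≈ 0#
  dualʳ-annihilates (suc n) σ occurs I = trans
    (form-suc n _ _ _ _ _ _ (vectors-combine n I) (kron₂-combineʳ n dualʳ σ) (ones-combine n))
    (product≈0 occurs)
    where
    product≈0 : Occurs (suc zero) (suc n) σ → form₁ (λ l → vector l (hd n I)) (dualʳ (hd n σ)) one
                                              * form n (vectors n (tl n I)) (kron₂ n dualʳ (tl n σ)) (ones n) ≈ 0#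
    product≈0 (inj₁ σ₁≡1)     = trans (*-congʳ (dualʳ-annihilates₁ σ₁≡1 (hd n I))) (zeroˡ _)
    product≈0 (inj₂ occurs′) = trans (*-congˡ (dualʳ-annihilates n (tl n σ) occurs′ (tl n I))) (zeroʳ _)

  gram : ∀ n σ τ → form n (kron₂ n dualˡ σ) (kron₂ n dualʳ τ) (ones n) ≃ Tensors.δ K σ τ ·ε^ n
  gram zero    zero zero = ≃-intro 0# (solve 1 (λ E → :1 :* (:1 :* (:1 :* :1)) :+ :0 := :1 :* (:1 :+ E :* :0)) refl ε) refl
  gram (suc n) σ τ = ≃-respʳ δ-split (≈-≃-trans
    (form-suc n _ _ _ _ _ _ (kron₂-combineʳ n dualˡ σ) (kron₂-combineʳ n dualʳ τ) (ones-combine n))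
    (≃-* (gram₁ (hd n σ) (hd n τ)) (gram n (tl n σ) (tl n τ))))
    where
    δ-split : Tensors.δ K (hd n σ) (hd n τ) K.* Tensors.δ K (tl n σ) (tl n τ) K.≈ Tensors.δ K σ τ
    δ-split = K.trans (K.sym (FiniteSums.δ-combine K (hd n σ) (hd n τ) (tl n σ) (tl n τ)))
      (K.reflexive (≡.cong₂ (Tensors.δ K) (FinP.combine-remQuot {2 ℕ.+ q} ((2 ℕ.+ q) ℕ.^ n) σ)
                                          (FinP.combine-remQuot {2 ℕ.+ q} ((2 ℕ.+ q) ℕ.^ n) τ)))

  Deg≤-kron : ∀ {m} n D {f : Fin m → Series} → (∀ x → Deg≤ D (f x)) → ∀ w → Deg≤ (n ℕ.* D) (kron n f w)
  Deg≤-kron zero    D f≤D w = Deg≤-const 0 K.1#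
  Deg≤-kron (suc n) D f≤D w = Deg≤-*ₛ (f≤D _) (Deg≤-kron n D f≤D _)

  Deg≤-kron₂ : ∀ {m k} n D {f : Fin m → Fin k → Series} → (∀ x y → Deg≤ D (f x y)) →
               ∀ w x → Deg≤ (n ℕ.* D) (kron₂ n f w x)
  Deg≤-kron₂ zero    D f≤D w x = Deg≤-const 0 K.1#
  Deg≤-kron₂ (suc n) D f≤D w x = Deg≤-*ₛ (f≤D _ _) (Deg≤-kron₂ n D f≤D _ _)

module Exponents (n : ℕ) where
  open Data.Nat.Solver.+-*-Solver using (solve; _:+_; _:*_; _:=_; con)

  -- The slice rows are scaled by ε^α and the z-rows of cw_q^⊗n by ε^β;
  -- both summands then appear at order e = 2α + n = β + 3n.
  α β e : ℕ
  α = suc (n ℕ.* 3)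
  β = suc (suc (n ℕ.* 4))
  e = β ℕ.+ n ℕ.* 3

  e<α+β : e < α ℕ.+ β
  e<α+β = s≤s (ℕP.≤-reflexive (ℕP.+-comm β (n ℕ.* 3)))

  e<α+0+β : e < α ℕ.+ 0 ℕ.+ β
  e<α+0+β = ≡.subst (λ k → e < k ℕ.+ β) (≡.sym (ℕP.+-identityʳ α)) e<α+β

  e<α+α+β : e < α ℕ.+ α ℕ.+ β
  e<α+α+β = ℕP.<-≤-trans e<α+β (ℕP.≤-trans (ℕP.m≤n+m (α ℕ.+ β) α) (ℕP.≤-reflexive (≡.sym (ℕP.+-assoc α α β))))

  α+α+0+n≡e : α ℕ.+ α ℕ.+ 0 ℕ.+ n ≡ e
  α+α+0+n≡e = solve 1 (λ n → (con 1 :+ n :* con 3) :+ (con 1 :+ n :* con 3) :+ con 0 :+ n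
                            := (con 2 :+ n :* con 4) :+ n :* con 3) ≡.refl n


module Construction {c ℓ : Level} (K : CommutativeRing c ℓ) (q n : ℕ) where
  private module K = CommutativeRing K
  open Tensors K using (cw; _⊗^_; _⊕_; unit; mm1s1; _⊴_)
  open FormalPowerSeries K
    using (Series; seriesRing; ε^_; ε^-+; Deg≤; Deg≤-mono; Deg≤-const; Deg≤-0ₛ; Deg≤--ₛ; Deg≤-*ₛ; Deg≤-ε^)
  open LeadingTerms K
  open SeriesDegenerations K
  open CommutativeRing seriesRing hiding (zero)
  open Tensors seriesRing using (ΣFin)
  open FiniteSums seriesRing
  open IntegerCoefficientSolver seriesRing using (solve; _:+_; _:*_; :-_; _:=_; :0; :1)
  open Words q using (Word; #containing01; containing01Word; containing01Word-injective; containing01Word-occurs)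
  open CoppersmithWinogradLetters K q
    using (weight; dualˡ; dualʳ; Deg≤-weight; Deg≤-vector; Deg≤-dualˡ; Deg≤-dualʳ; Deg≤-factorˡ; Deg≤-factorʳ)
  open KroneckerPowers seriesRing using (kron; kron₂)
  open CoppersmithWinogradPowers K q
  open Exponents n

  N R Q s : ℕ
  N = suc q ℕ.^ n
  R = (2 ℕ.+ q) ℕ.^ n
  Q = q ℕ.^ n
  s = #containing01 n

  σ : Fin s → Word n
  σ = containing01Word n

  Row Column : Set
  Row    = Fin N ⊎ Fin s
  Column = Fin N ⊎ Fin 1

  scaleRow : Row → ℕ
  scaleRow (inj₁ _) = 0
  scaleRow (inj₂ _) = α

  scaleColumn : Column → ℕ
  scaleColumn (inj₁ _) = β
  scaleColumn (inj₂ _) = 0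

  rowˡ rowʳ : Row → Word n → Series
  rowˡ (inj₁ I) = vectors n I
  rowˡ (inj₂ j) = kron₂ n dualˡ (σ j)
  rowʳ (inj₁ J) = vectors n J
  rowʳ (inj₂ j) = kron₂ n dualʳ (σ j)

  column : Column → Word n → Series
  column (inj₁ L) = vectors n L
  column (inj₂ _) = ones n

  Ablocks Bblocks : Row → Fin R ⊎ Fin Q → Series
  Ablocks x        (inj₁ w) = ε^ scaleRow x * rowˡ x w
  Ablocks (inj₁ I) (inj₂ m) = factorsˡ n m I
  Ablocks (inj₂ _) (inj₂ _) = 0#
  Bblocks y        (inj₁ w) = ε^ scaleRow y * rowʳ y w
  Bblocks (inj₁ J) (inj₂ m) = factorsʳ n m J
  Bblocks (inj₂ _) (inj₂ _) = 0#

  Cblocks : Column → Fin R ⊎ Fin 1 → Series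
  Cblocks z        (inj₁ w) = ε^ scaleColumn z * (kron n weight w * column z w)
  Cblocks (inj₁ _) (inj₂ _) = 0#
  Cblocks (inj₂ _) (inj₂ _) = - ε^ (n ℕ.* 3)

  unitPart mmPart : Row → Row → Column → Series
  unitPart x y z = ΣFin R (λ w → Ablocks x (inj₁ w) * (Bblocks y (inj₁ w) * Cblocks z (inj₁ w)))
  mmPart x y z = ΣFin Q (λ m → Ablocks x (inj₂ m) * (Bblocks y (inj₂ m) * Cblocks z (inj₂ zero)))

  unitPart-form : ∀ x y z → unitPart x y z
                  ≈ ε^ (scaleRow x ℕ.+ scaleRow y ℕ.+ scaleColumn z) * form n (rowˡ x) (rowʳ y) (column z)
  unitPart-form x y z = trans
    (ΣFin-cong R λ w → solve 7 (λ A B C S U V X → (A :* U) :* ((B :* V) :* (C :* (S :* X)))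
                                                 := ((A :* B) :* C) :* (S :* (U :* (V :* X))))
                               refl (ε^ a) (ε^ b) (ε^ d) (kron n weight w) (rowˡ x w) (rowʳ y w) (column z w))
    (trans (sym (*-distribˡ-ΣFin R _ _))
           (*-congʳ (sym (trans (ε^-+ (a ℕ.+ b) d) (*-congʳ (ε^-+ a b))))))
    where
    a = scaleRow x
    b = scaleRow y
    d = scaleColumn z

  ≃-unitPart : ∀ x y z {t} → mmPart x y z ≈ 0# →
               ε^ (scaleRow x ℕ.+ scaleRow y ℕ.+ scaleColumn z) * form n (rowˡ x) (rowʳ y) (column z) ≃ t ·ε^ e →
               unitPart x y z + mmPart x y z ≃ t ·ε^ e
  ≃-unitPart x y z mm≈0 = ≈-≃-trans (trans (+-cong (unitPart-form x y z) mm≈0) (+-identityʳ _))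

  blocks-expansion : ∀ x y z → unitPart x y z + mmPart x y z ≃ block (cw q ⊗^ n) (mm1s1 s) x y z ·ε^ e
  blocks-expansion (inj₁ I) (inj₁ J) (inj₁ L) =
    ≃-unitPart (inj₁ I) (inj₁ J) (inj₁ L) (ΣFin-zero Q λ _ → trans (*-congˡ (zeroʳ _)) (zeroʳ _))
      (ε^-*-≃ β (cw-border n I J L))
  blocks-expansion (inj₁ I) (inj₁ J) (inj₂ z) = ≈-≃-trans (begin
    unitPart (inj₁ I) (inj₁ J) (inj₂ z) + mmPart (inj₁ I) (inj₁ J) (inj₂ z)
      ≈⟨ +-cong (trans (unitPart-form (inj₁ I) (inj₁ J) (inj₂ z)) (*-congˡ (pairing n I J)))
                (trans (ΣFin-cong Q λ m → solve 3 (λ A B E → A :* (B :* (:- E)) := :- E :* (A :* B))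
                                                  refl (factorsˡ n m I) (factorsʳ n m J) (ε^ (n ℕ.* 3)))
                       (sym (*-distribˡ-ΣFin Q _ _))) ⟩
    1# * (ε^ (n ℕ.* 3) * P) + - ε^ (n ℕ.* 3) * P
      ≈⟨ solve 2 (λ E P → :1 :* (E :* P) :+ :- E :* P := :0) refl (ε^ (n ℕ.* 3)) P ⟩
    0# ∎) (0≃ e)
    where
    open ≈-Reasoning setoid
    P = ΣFin Q (λ m → factorsˡ n m I * factorsʳ n m J)
  blocks-expansion (inj₂ j) (inj₁ J) (inj₂ z) =
    ≃-unitPart (inj₂ j) (inj₁ J) (inj₂ z) (ΣFin-zero Q λ _ → zeroˡ _) (≈-≃-trans
      (trans (*-congˡ (dualˡ-annihilates n (σ j) (proj₁ (containing01Word-occurs n j)) J)) (zeroʳ _))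
      (0≃ e))
  blocks-expansion (inj₁ I) (inj₂ j) (inj₂ z) =
    ≃-unitPart (inj₁ I) (inj₂ j) (inj₂ z) (ΣFin-zero Q λ _ → trans (*-congˡ (zeroˡ _)) (zeroʳ _)) (≈-≃-trans
      (trans (*-congˡ (dualʳ-annihilates n (σ j) (proj₂ (containing01Word-occurs n j)) I)) (zeroʳ _))
      (0≃ e))
  blocks-expansion (inj₂ j) (inj₂ j′) (inj₂ z) =
    ≃-unitPart (inj₂ j) (inj₂ j′) (inj₂ z) (ΣFin-zero Q λ _ → zeroˡ _)
      (≃-respʳ (FiniteSums.δ-injective K σ (containing01Word-injective n) j j′)
        (≃-reindex α+α+0+n≡e (ε^-*-≃ (α ℕ.+ α ℕ.+ 0) (gram n (σ j) (σ j′)))))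
  blocks-expansion (inj₂ j) (inj₁ J) (inj₁ L) =
    ≃-unitPart (inj₂ j) (inj₁ J) (inj₁ L) (ΣFin-zero Q λ _ → zeroˡ _) (≃-negligible e _ e<α+0+β)
  blocks-expansion (inj₁ I) (inj₂ j) (inj₁ L) =
    ≃-unitPart (inj₁ I) (inj₂ j) (inj₁ L) (ΣFin-zero Q λ _ → trans (*-congˡ (zeroˡ _)) (zeroʳ _)) (≃-negligible e _ e<α+β)
  blocks-expansion (inj₂ j) (inj₂ j′) (inj₁ L) =
    ≃-unitPart (inj₂ j) (inj₂ j′) (inj₁ L) (ΣFin-zero Q λ _ → zeroˡ _) (≃-negligible e _ e<α+α+β)

  Deg≤-Ablocks : ∀ x y → Deg≤ (α ℕ.+ n ℕ.* 2) (Ablocks x y)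
  Deg≤-Ablocks (inj₁ I) (inj₁ w) = Deg≤-mono (ℕP.m≤n+m (n ℕ.* 2) α)
    (Deg≤-*ₛ (Deg≤-ε^ 0) (Deg≤-kron₂ n 2 Deg≤-vector w I))
  Deg≤-Ablocks (inj₂ j) (inj₁ w) = Deg≤-mono (ℕP.+-monoʳ-≤ α (ℕP.*-monoʳ-≤ n (s≤s z≤n)))
    (Deg≤-*ₛ (Deg≤-ε^ α) (Deg≤-kron₂ n 1 Deg≤-dualˡ (σ j) w))
  Deg≤-Ablocks (inj₁ I) (inj₂ m) = Deg≤-mono (ℕP.≤-trans (ℕP.≤-reflexive (ℕP.*-zeroʳ n)) z≤n)
    (Deg≤-kron₂ n 0 Deg≤-factorˡ m I)
  Deg≤-Ablocks (inj₂ j) (inj₂ m) = Deg≤-0ₛ _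

  Deg≤-Bblocks : ∀ y w → Deg≤ (α ℕ.+ n ℕ.* 2) (Bblocks y w)
  Deg≤-Bblocks (inj₁ J) (inj₁ w) = Deg≤-mono (ℕP.m≤n+m (n ℕ.* 2) α)
    (Deg≤-*ₛ (Deg≤-ε^ 0) (Deg≤-kron₂ n 2 Deg≤-vector w J))
  Deg≤-Bblocks (inj₂ j) (inj₁ w) = Deg≤-mono (ℕP.+-monoʳ-≤ α (ℕP.*-monoʳ-≤ n (s≤s z≤n)))
    (Deg≤-*ₛ (Deg≤-ε^ α) (Deg≤-kron₂ n 1 Deg≤-dualʳ (σ j) w))
  Deg≤-Bblocks (inj₁ J) (inj₂ m) = Deg≤-mono (ℕP.≤-trans (ℕP.*-monoʳ-≤ n (s≤s z≤n)) (ℕP.m≤n+m (n ℕ.* 2) α))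
    (Deg≤-kron₂ n 1 Deg≤-factorʳ m J)
  Deg≤-Bblocks (inj₂ j) (inj₂ m) = Deg≤-0ₛ _

  Deg≤-Cblocks : ∀ z w → Deg≤ (β ℕ.+ (n ℕ.* 1 ℕ.+ n ℕ.* 2)) (Cblocks z w)
  Deg≤-Cblocks (inj₁ L) (inj₁ w) =
    Deg≤-*ₛ (Deg≤-ε^ β) (Deg≤-*ₛ (Deg≤-kron n 1 Deg≤-weight w) (Deg≤-kron₂ n 2 Deg≤-vector w L))
  Deg≤-Cblocks (inj₂ _) (inj₁ w) =
    Deg≤-mono (ℕP.≤-trans (ℕP.+-monoʳ-≤ (n ℕ.* 1) z≤n) (ℕP.m≤n+m _ β))
      (Deg≤-*ₛ (Deg≤-ε^ 0) (Deg≤-*ₛ (Deg≤-kron n 1 Deg≤-weight w) (Deg≤-const 0 K.1#)))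
  Deg≤-Cblocks (inj₁ _) (inj₂ _) = Deg≤-0ₛ _
  Deg≤-Cblocks (inj₂ _) (inj₂ _) =
    Deg≤-mono (ℕP.≤-trans (ℕP.≤-reflexive (ℕP.*-distribˡ-+ n 1 2)) (ℕP.m≤n+m _ β)) (Deg≤--ₛ (Deg≤-ε^ (n ℕ.* 3)))

  degeneration : ((cw q ⊗^ n) ⊕ mm1s1 s) ⊴ (unit R ⊕ mm1s1 Q)
  degeneration = ⊴-from-series (blockMatrix Ablocks) (blockMatrix Bblocks) (blockMatrix Cblocks)
    (blockMatrix-degree _ Deg≤-Ablocks) (blockMatrix-degree _ Deg≤-Bblocks) (blockMatrix-degree _ Deg≤-Cblocks)
    e expansion
    where
    Expansion : Fin (N ℕ.+ s) → Fin (N ℕ.+ s) → Fin (N ℕ.+ 1) → Set (c ⊔ ℓ)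
    Expansion i j k = transform (blockMatrix Ablocks) (blockMatrix Bblocks) (blockMatrix Cblocks)
                        (unit R ⊕ mm1s1 Q) i j k ≃ ((cw q ⊗^ n) ⊕ mm1s1 s) i j k ·ε^ e

    expansion-join : ∀ x y z → Expansion (join N s x) (join N s y) (join N 1 z)
    expansion-join x y z = ≃-respʳ (K.reflexive (≡.sym (⊕-join (cw q ⊗^ n) (mm1s1 s) x y z)))
      (≈-≃-trans (transform-unit⊕mm1s1 Ablocks Bblocks Cblocks x y z) (blocks-expansion x y z))

    along : ∀ {i i′ j j′ k k′} → i ≡ i′ → j ≡ j′ → k ≡ k′ → Expansion i j k → Expansion i′ j′ k′
    along ≡.refl ≡.refl ≡.refl expansion = expansion

    expansion : ∀ i j k → Expansion i j k
    expansion i j k = along (FinP.join-splitAt N s i) (FinP.join-splitAt N s j) (FinP.join-splitAt N 1 k)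
      (expansion-join (splitAt N i) (splitAt N j) (splitAt N k))

open import Data.Nat using (_+_; _*_; _^_; _≥_)

proposition7p2 : {c ℓ : Level} (K : CommutativeRing c ℓ) → IsChar0Field K →
    let open Tensors K in
    (q n : ℕ) → q ≥ 2 → n ≥ 1 →
    ((cw q ⊗^ n) ⊕ mm1s1 (((q + 2) ^ n + q ^ n) ∸ 2 * (q + 1) ^ n))
      ⊴ (unit ((q + 2) ^ n) ⊕ mm1s1 (q ^ n))
proposition7p2 K _ q n _ _ =
  ≡.subst₂ (λ s r → ((cw q ⊗^ n) ⊕ mm1s1 s) ⊴ (unit (r ^ n) ⊕ mm1s1 (q ^ n)))
           (≡.sym (Words.#containing01-≡ q n)) (ℕP.+-comm 2 q)
           (Construction.degeneration K q n)
  where open Tensors K
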